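{- Let $a$ be a rational number with $2<a<\frac{24}{7}$. Then there are infinitely many ESPP instances $(n,k,P)$ with $n/k=a$ that are not solvable.
   Context: For positive integers $n,k$ with $k$ dividing $n(n+1)/2$, put $s^{n,k}=\frac{n(n+1)}{2k}$. For a non-descending sequence of positive integers $P=[p_1,\dots,p_k]$ with $p_1+\cdots+p_k=n$ (a non-descending composition of $n$), let $P_j=\sum_{i=1}^j p_i$, $\mathrm{slack}_j(P)=\sum_{i=1}^{P_j}(n-i+1)-j\,s^{n,k}$ for $1\le j\le k-1$, and $\mathrm{slack}(P)=\min_{1\le j<k}\mathrm{slack}_j(P)$. An ESPP instance is a triple $(n,k,P)$ where $n,k$ are positive integers with $k\mid n(n+1)/2$ and $P$ is a non-descending composition of $n$ into $k$ parts with $\mathrm{slack}(P)\ge 0$. It is solvable if $\{1,\dots,n\}$ can be partitioned into sets $A_1,\dots,A_k$ with $|A_j|=p_j$ and $\sum_{x\in A_j}x=s^{n,k}$ for every $j$. -}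

module Defs where

open import Data.Nat as ℕ using (ℕ; zero; suc; _+_; _*_; _∸_; _≤_; _<_; NonZero)
open import Data.Nat.DivMod using (_/_)
open import Data.Nat.Divisibility using (_∣_)
open import Data.Integer as ℤ using (ℤ; +_; _-_)
open import Data.Fin as Fin using (Fin; toℕ)
open import Data.Vec as Vec using (Vec; lookup; toList)
open import Data.Nat.ListAction using (sum)
open import Data.List as List using (List; map; upTo; filter; length; take; allFin)
open import Data.Product using (Σ; _×_; ∃)
open import Relation.Binary.PropositionalEquality using (_≡_)
open import Relation.Nullary.Decidable using (⌊_⌋)

tri : ℕ → ℕ
tri n = (n * suc n) / 2

-- s^{n,k} = n(n+1)/(2k)  (k ≥ 1; meaningful when k ∣ n(n+1)/2)
sNK : (n k : ℕ) → .{{NonZero k}} → ℕ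
sNK n k = tri n / k

-- Σ_{i=1}^{m} (n - i + 1)
topSum : ℕ → ℕ → ℕ
topSum n m = sum (map (λ i → n ∸ i) (upTo m))

prefixSum : ∀ {k} → Vec ℕ k → ℕ → ℕ
prefixSum P j = sum (take j (toList P))

slackJ : (n k : ℕ) → .{{NonZero k}} → Vec ℕ k → ℕ → ℤ
slackJ n k P j = + topSum n (prefixSum P j) - + (j * sNK n k)

IsNonDescComposition : (n k : ℕ) → Vec ℕ k → Set
IsNonDescComposition n k P =
  (∀ i → 1 ≤ lookup P i) ×
  (∀ (i j : Fin k) → i Fin.≤ j → lookup P i ≤ lookup P j) ×
  (sum (toList P) ≡ n)

-- slack(P) = min_{1 ≤ j < k} slack_j(P) ≥ 0
SlackNonNeg : (n k : ℕ) → .{{NonZero k}} → Vec ℕ k → Set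
SlackNonNeg n k P = ∀ j → 1 ≤ j → j < k → + 0 ℤ.≤ slackJ n k P j

record ESPP : Set where
  field
    n : ℕ
    k : ℕ
    n-pos : 1 ≤ n
    k-pos : 1 ≤ k
    k∣tri : k ∣ tri n
    P : Vec ℕ k
    P-comp : IsNonDescComposition n k P
    P-slack : SlackNonNeg n k {{ℕ.>-nonZero k-pos}} P

-- A partition of {1,...,n} into k labelled blocks A_1..A_k:
-- f i = j means the element (toℕ i + 1) lies in A_{j+1}.
block : ∀ {n k} → (Fin n → Fin k) → Fin k → List (Fin n)
block {n} f j = filter (λ i → f i Fin.≟ j) (allFin n)

blockSize : ∀ {n k} → (Fin n → Fin k) → Fin k → ℕ
blockSize f j = length (block f j)

blockSum : ∀ {n k} → (Fin n → Fin k) → Fin k → ℕ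
blockSum f j = sum (map (λ i → suc (toℕ i)) (block f j))

Solvable : ESPP → Set
Solvable I = ∃ λ (f : Fin n → Fin k) →
  ∀ j → (blockSize f j ≡ lookup P j) × (blockSum f j ≡ sNK n k {{ℕ.>-nonZero k-pos}})
  where open ESPP I

module Submission where

-- Write a = N / D in lowest terms; for n = N m and k = D m every block must sum to s = N (n + 1) / (2 D).
-- Pick p with 4 (p − 1) / (2 p − 3) < a < 4 p (p − 1) / (2 p² − 5 p + 4) and build P from runs of parts
-- 2, p, p + 1, q, q + 1, where the first J blocks (the runs of 2, p and p + 1: j pairs, then larger blocks)
-- have total size L and J s + e is the sum of the L largest numbers u, …, n, with e < s.  The slack is
-- concave along a run, so it is nonnegative as soon as it is at the run boundaries.
--
-- In a solution let U be the union of the first J blocks and d the number of its elements below u.  As U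
-- has as many elements as {u, …, n} and only e less sum, W d ≤ W² + e for any W < u.  A block holds at
-- most one number ≥ h > s / 2, and a block of at least p parts holding one also holds a number below u;
-- since the numbers ≥ h outside U are among the d top numbers missing from U, there are X ≤ j + 2 d of
-- them.  For m large the window on a makes W X exceed W j + 2 (W² + e), a contradiction.

module FiniteSums where

  open import Data.Fin using (toℕ)
  open import Data.List using (List; []; _∷_; map; filter; length; allFin; tabulate; applyUpTo)
  open import Data.List.Properties using (map-tabulate)
  open import Data.Nat using (ℕ; zero; suc; _+_; _*_; _≤_; _<_; z≤n)
  open import Data.Nat.ListAction using (sum)
  open import Data.Nat.Properties
  open import Algebra.Properties.CommutativeSemigroup +-commutativeSemigroup using (interchange)
  open import Function using (_∘_)
  open import Relation.Binary.PropositionalEquality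
  open import Relation.Nullary using (Dec; yes; no)

  ∑ : {A : Set} → List A → (A → ℕ) → ℕ
  ∑ xs f = sum (map f xs)

  syntax ∑ xs (λ x → f) = ∑[ x ∈ xs ] f

  ∑< : ℕ → (ℕ → ℕ) → ℕ
  ∑< zero    f = 0
  ∑< (suc n) f = ∑< n f + f n

  syntax ∑< n (λ x → f) = ∑[ x < n ] f

  infixl 3 _when_

  _when_ : {P : Set} → ℕ → Dec P → ℕ
  t when yes _ = t
  t when no _  = 0

  module _ {A : Set} where

    ∑-cong : (xs : List A) {f g : A → ℕ} → (∀ x → f x ≡ g x) → ∑ xs f ≡ ∑ xs g
    ∑-cong []       eq = refl
    ∑-cong (x ∷ xs) eq = cong₂ _+_ (eq x) (∑-cong xs eq)

    ∑-zero : (xs : List A) → ∑[ x ∈ xs ] 0 ≡ 0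
    ∑-zero []       = refl
    ∑-zero (x ∷ xs) = ∑-zero xs

    ∑-mono : (xs : List A) {f g : A → ℕ} → (∀ x → f x ≤ g x) → ∑ xs f ≤ ∑ xs g
    ∑-mono []       le = z≤n
    ∑-mono (x ∷ xs) le = +-mono-≤ (le x) (∑-mono xs le)

    ∑-+ : (xs : List A) (f g : A → ℕ) → ∑[ x ∈ xs ] (f x + g x) ≡ ∑ xs f + ∑ xs g
    ∑-+ []       f g = refl
    ∑-+ (x ∷ xs) f g = trans (cong (f x + g x +_) (∑-+ xs f g)) (interchange (f x) (g x) (∑ xs f) (∑ xs g))

    ∑-+₃ : (xs : List A) (f g h : A → ℕ) → ∑[ x ∈ xs ] (f x + g x + h x) ≡ ∑ xs f + ∑ xs g + ∑ xs h
    ∑-+₃ xs f g h = trans (∑-+ xs _ h) (cong (_+ ∑ xs h) (∑-+ xs f g))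

    ∑-*ˡ : (xs : List A) (c : ℕ) (f : A → ℕ) → ∑[ x ∈ xs ] (c * f x) ≡ c * ∑ xs f
    ∑-*ˡ []       c f = sym (*-zeroʳ c)
    ∑-*ˡ (x ∷ xs) c f = trans (cong (c * f x +_) (∑-*ˡ xs c f)) (sym (*-distribˡ-+ c (f x) (∑ xs f)))

    module _ {P : A → Set} (P? : (x : A) → Dec (P x)) where

      length-filter≡∑when : (xs : List A) → length (filter P? xs) ≡ ∑[ x ∈ xs ] (1 when P? x)
      length-filter≡∑when []       = refl
      length-filter≡∑when (x ∷ xs) with P? x
      ... | yes _ = cong suc (length-filter≡∑when xs)
      ... | no _  = length-filter≡∑when xs

      sum-filter≡∑when : (xs : List A) (f : A → ℕ) → sum (map f (filter P? xs)) ≡ ∑[ x ∈ xs ] (f x when P? x)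
      sum-filter≡∑when []       f = refl
      sum-filter≡∑when (x ∷ xs) f with P? x
      ... | yes _ = cong (f x +_) (sum-filter≡∑when xs f)
      ... | no _  = sum-filter≡∑when xs f

    when-const : ∀ t {P : Set} (d : Dec P) → (t when d) ≡ t * (1 when d)
    when-const t (yes _) = sym (*-identityʳ t)
    when-const t (no _)  = sym (*-zeroʳ t)

    when-const₂ : ∀ t {P Q : Set} (d : Dec P) (d′ : Dec Q) → (t when d when d′) ≡ t * (1 when d when d′)
    when-const₂ t d (yes _) = when-const t d
    when-const₂ t d (no _)  = sym (*-zeroʳ t)

    ∑-when-const : (xs : List A) (t : ℕ) {P : A → Set} (P? : ∀ x → Dec (P x)) →
      ∑[ x ∈ xs ] (t when P? x) ≡ t * ∑[ x ∈ xs ] (1 when P? x)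
    ∑-when-const xs t P? = trans (∑-cong xs (λ x → when-const t (P? x))) (∑-*ˡ xs t _)

    ∑-when-const₂ : (xs : List A) (t : ℕ) {P Q : A → Set} (P? : ∀ x → Dec (P x)) (Q? : ∀ x → Dec (Q x)) →
      ∑[ x ∈ xs ] (t when P? x when Q? x) ≡ t * ∑[ x ∈ xs ] (1 when P? x when Q? x)
    ∑-when-const₂ xs t P? Q? = trans (∑-cong xs (λ x → when-const₂ t (P? x) (Q? x))) (∑-*ˡ xs t _)

  ∑<-cong : ∀ n {f g : ℕ → ℕ} → (∀ x → x < n → f x ≡ g x) → ∑< n f ≡ ∑< n g
  ∑<-cong zero    eq = refl
  ∑<-cong (suc n) eq = cong₂ _+_ (∑<-cong n λ x x<n → eq x (m<n⇒m<1+n x<n)) (eq n ≤-refl)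

  ∑<-mono : ∀ n {f g : ℕ → ℕ} → (∀ x → x < n → f x ≤ g x) → ∑< n f ≤ ∑< n g
  ∑<-mono zero    le = z≤n
  ∑<-mono (suc n) le = +-mono-≤ (∑<-mono n λ x x<n → le x (m<n⇒m<1+n x<n)) (le n ≤-refl)

  ∑<-+ : ∀ n (f g : ℕ → ℕ) → ∑[ x < n ] (f x + g x) ≡ ∑< n f + ∑< n g
  ∑<-+ zero    f g = refl
  ∑<-+ (suc n) f g = trans (cong (_+ (f n + g n)) (∑<-+ n f g)) (interchange (∑< n f) (∑< n g) (f n) (g n))

  ∑<-const : ∀ n c → ∑[ _ < n ] c ≡ n * c
  ∑<-const zero    c = refl
  ∑<-const (suc n) c = trans (cong (_+ c) (∑<-const n c)) (+-comm (n * c) c)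

  ∑<-suc : ∀ n (f : ℕ → ℕ) → ∑< (suc n) f ≡ f 0 + ∑[ x < n ] f (suc x)
  ∑<-suc zero    f = +-comm 0 (f 0)
  ∑<-suc (suc n) f = trans (cong (_+ f (suc n)) (∑<-suc n f)) (+-assoc (f 0) _ _)

  ∑<-+ˡ : ∀ m n (f : ℕ → ℕ) → ∑< (m + n) f ≡ ∑< m f + ∑[ x < n ] f (m + x)
  ∑<-+ˡ m zero    f = trans (cong (λ k → ∑< k f) (+-identityʳ m)) (sym (+-identityʳ _))
  ∑<-+ˡ m (suc n) f = begin
    ∑< (m + suc n) f                          ≡⟨ cong (λ k → ∑< k f) (+-suc m n) ⟩
    ∑< (m + n) f + f (m + n)                  ≡⟨ cong (_+ f (m + n)) (∑<-+ˡ m n f) ⟩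
    ∑< m f + ∑[ x < n ] f (m + x) + f (m + n) ≡⟨ +-assoc (∑< m f) _ _ ⟩
    ∑< m f + ∑[ x < suc n ] f (m + x)         ∎
    where open ≡-Reasoning

  ∑-applyUpTo : ∀ n (f : ℕ → ℕ) → sum (applyUpTo f n) ≡ ∑< n f
  ∑-applyUpTo zero    f = refl
  ∑-applyUpTo (suc n) f = trans (cong (f 0 +_) (∑-applyUpTo n (f ∘ suc))) (sym (∑<-suc n f))

  tabulate-toℕ : ∀ n (f : ℕ → ℕ) → tabulate {n = n} (f ∘ toℕ) ≡ applyUpTo f n
  tabulate-toℕ zero    f = refl
  tabulate-toℕ (suc n) f = cong (f 0 ∷_) (tabulate-toℕ n (f ∘ suc))

  ∑-allFin : ∀ n (f : ℕ → ℕ) → ∑[ i ∈ allFin n ] f (toℕ i) ≡ ∑< n f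
  ∑-allFin n f = begin
    sum (map (f ∘ toℕ) (allFin n))     ≡⟨ cong sum (map-tabulate {n = n} (λ i → i) (f ∘ toℕ)) ⟩
    sum (tabulate {n = n} (f ∘ toℕ))   ≡⟨ cong sum (tabulate-toℕ n f) ⟩
    sum (applyUpTo f n)                ≡⟨ ∑-applyUpTo n f ⟩
    ∑< n f                             ∎
    where open ≡-Reasoning

module Exchange where

  open FiniteSums
  open import Data.Empty using (⊥; ⊥-elim)
  open import Data.Fin using (Fin; toℕ)
  open import Data.List using (List; allFin)
  open import Data.Nat using (ℕ; zero; suc; _+_; _*_; _∸_; _≤_; _<_; z≤n; s≤s; _≟_; _≤?_; _<?_)
  open import Data.Nat.Properties
  open import Data.Nat.Tactic.RingSolver using (solve-∀)
  open import Relation.Binary.PropositionalEquality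
  open import Relation.Nullary using (Dec; yes; no)

  open ≤-Reasoning

  count-≥ : ∀ n c → ∑[ x < n ] (1 when suc c ≤? suc x) ≡ n ∸ c
  count-≥ zero    c = sym (0∸n≡0 c)
  count-≥ (suc n) c with suc c ≤? suc n
  ... | yes (s≤s c≤n) = trans (cong (_+ 1) (count-≥ n c)) (trans (+-comm (n ∸ c) 1) (sym (+-∸-assoc 1 c≤n)))
  ... | no c≰n        = trans (+-identityʳ _) (trans (count-≥ n c) (trans (m≤n⇒m∸n≡0 (≤-trans (n≤1+n n) n<c)) (sym (m≤n⇒m∸n≡0 n<c))))
    where
    n<c : n < c
    n<c = ≤-pred (≰⇒> c≰n)

  when-window-split : ∀ a b x → a ≤ b → (1 when a ≤? x when x <? b) + (1 when b ≤? x) ≡ (1 when a ≤? x)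
  when-window-split a b x a≤b with x <? b | a ≤? x | b ≤? x
  ... | yes x<b | _       | yes b≤x = ⊥-elim (<-irrefl refl (<-≤-trans x<b b≤x))
  ... | yes _   | yes _   | no _    = refl
  ... | yes _   | no _    | no _    = refl
  ... | no x≮b  | _       | no b≰x  = ⊥-elim (b≰x (≮⇒≥ x≮b))
  ... | no _    | yes _   | yes _   = refl
  ... | no _    | no a≰x  | yes b≤x = ⊥-elim (a≰x (≤-trans a≤b b≤x))

  count-window : ∀ n a b → a ≤ b → b ≤ n →
    ∑[ x < n ] (1 when suc a ≤? suc x when suc x <? suc b) ≡ b ∸ a
  count-window n a b a≤b b≤n = +-cancelʳ-≡ (n ∸ b) _ _ (begin-equality
    ∑[ x < n ] (1 when suc a ≤? suc x when suc x <? suc b) + (n ∸ b)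
      ≡⟨ cong (∑[ x < n ] (1 when suc a ≤? suc x when suc x <? suc b) +_) (count-≥ n b) ⟨
    ∑[ x < n ] (1 when suc a ≤? suc x when suc x <? suc b) + ∑[ x < n ] (1 when suc b ≤? suc x)
      ≡⟨ ∑<-+ n _ _ ⟨
    ∑[ x < n ] ((1 when suc a ≤? suc x when suc x <? suc b) + (1 when suc b ≤? suc x))
      ≡⟨ ∑<-cong n (λ x _ → when-window-split (suc a) (suc b) (suc x) (s≤s a≤b)) ⟩
    ∑[ x < n ] (1 when suc a ≤? suc x)
      ≡⟨ count-≥ n a ⟩
    n ∸ a
      ≡⟨ n∸a-split ⟩
    b ∸ a + (n ∸ b) ∎)
    where
    n∸a-split : n ∸ a ≡ b ∸ a + (n ∸ b)
    n∸a-split = begin-equality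
      n ∸ a                   ≡⟨ cong (_∸ a) (m∸n+n≡m b≤n) ⟨
      n ∸ b + b ∸ a           ≡⟨ +-∸-assoc (n ∸ b) a≤b ⟩
      n ∸ b + (b ∸ a)         ≡⟨ +-comm (n ∸ b) (b ∸ a) ⟩
      b ∸ a + (n ∸ b)         ∎

  value : ∀ {n} → Fin n → ℕ
  value i = suc (toℕ i)

  module _ {n : ℕ} where

    count-≥-value : ∀ L u → 1 ≤ u → L + u ≡ suc n → ∑[ i ∈ allFin n ] (1 when u ≤? value i) ≡ L
    count-≥-value L (suc u) _ L+u≡ = begin-equality
      ∑[ i ∈ allFin n ] (1 when suc u ≤? value i) ≡⟨ ∑-allFin n (λ x → 1 when suc u ≤? suc x) ⟩
      ∑[ x < n ] (1 when suc u ≤? suc x)          ≡⟨ count-≥ n u ⟩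
      n ∸ u                                       ≡⟨ cong (_∸ u) (suc-injective (trans (sym (+-suc L u)) L+u≡)) ⟨
      L + u ∸ u                                   ≡⟨ m+n∸n≡m L u ⟩
      L                                           ∎

    count-window-value : ∀ L u W → W < u → L + u ≡ suc n →
      ∑[ i ∈ allFin n ] (1 when u ∸ W ≤? value i when value i <? u) ≡ W
    count-window-value L (suc u) W (s≤s W≤u) L+u≡ = begin-equality
      ∑[ i ∈ allFin n ] (1 when suc u ∸ W ≤? value i when value i <? suc u)
        ≡⟨ cong (λ a → ∑[ i ∈ allFin n ] (1 when a ≤? value i when value i <? suc u)) (+-∸-assoc 1 W≤u) ⟩
      ∑[ i ∈ allFin n ] (1 when suc (u ∸ W) ≤? value i when value i <? suc u)
        ≡⟨ ∑-allFin n (λ x → 1 when suc (u ∸ W) ≤? suc x when suc x <? suc u) ⟩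
      ∑[ x < n ] (1 when suc (u ∸ W) ≤? suc x when suc x <? suc u)
        ≡⟨ count-window n (u ∸ W) u (m∸n≤m u W) u≤n ⟩
      u ∸ (u ∸ W)
        ≡⟨ m∸[m∸n]≡n W≤u ⟩
      W ∎
      where
      u≤n : u ≤ n
      u≤n = ≤-pred (subst (suc u ≤_) L+u≡ (m≤n+m (suc u) L))

  exchange-pointwise : ∀ {P : Set} (d : Dec P) W u x → W ≤ u →
    (W when x <? u when d) + (x when d) + (u when u ≤? x)
      ≤ (W when u ∸ W ≤? x when x <? u) + (x when u ≤? x) + (u when d)
  exchange-pointwise d W u x W≤u with x <? u | u ≤? x
  ... | yes x<u | yes u≤x = ⊥-elim (<-irrefl refl (<-≤-trans x<u u≤x))
  ... | no x≮u  | no u≰x  = ⊥-elim (u≰x (≮⇒≥ x≮u))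
  ... | no _    | yes u≤x with d
  ...   | yes _ = ≤-refl
  ...   | no _  = ≤-trans u≤x (m≤m+n x 0)
  exchange-pointwise d W u x W≤u | yes x<u | no _ with d | u ∸ W ≤? x
  ... | no _  | _       = z≤n
  ... | yes _ | yes _   = begin
    W + x + 0     ≡⟨ +-identityʳ (W + x) ⟩
    W + x         ≤⟨ +-monoʳ-≤ W (<⇒≤ x<u) ⟩
    W + u         ≡⟨ cong (_+ u) (+-identityʳ W) ⟨
    W + 0 + u     ∎
  ... | yes _ | no u∸W≰x = begin
    W + x + 0     ≡⟨ +-identityʳ (W + x) ⟩
    W + x         ≡⟨ +-comm W x ⟩
    x + W         ≤⟨ +-monoˡ-≤ W (<⇒≤ (≰⇒> u∸W≰x)) ⟩
    u ∸ W + W     ≡⟨ m∸n+n≡m W≤u ⟩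
    u             ∎

  module _ {n : ℕ} {P : Fin n → Set} (U? : ∀ i → Dec (P i)) where

    exchange-bound : ∀ L u W S e → W < u → L + u ≡ suc n →
      ∑[ i ∈ allFin n ] (1 when U? i) ≡ L →
      ∑[ i ∈ allFin n ] (value i when U? i) ≡ S →
      ∑[ i ∈ allFin n ] (value i when u ≤? value i) ≡ S + e →
      W * ∑[ i ∈ allFin n ] (1 when value i <? u when U? i) ≤ W * W + e
    exchange-bound L u W S e W<u L+u≡ |U|≡L ∑U≡S ∑top≡ =
      +-cancelʳ-≤ S _ _ (+-cancelʳ-≤ (u * L) _ _ (begin
        W * small + S + u * L
          ≡⟨ cong₃ (∑-when-const₂ xs W (λ i → value i <? u) U?) ∑U≡S
                    (trans (∑-when-const xs u (λ i → u ≤? value i)) (cong (u *_) |top|≡L)) ⟨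
        ∑[ i ∈ xs ] (W when value i <? u when U? i) + ∑[ i ∈ xs ] (value i when U? i)
          + ∑[ i ∈ xs ] (u when u ≤? value i)
          ≡⟨ ∑-+₃ xs _ _ _ ⟨
        ∑[ i ∈ xs ] ((W when value i <? u when U? i) + (value i when U? i) + (u when u ≤? value i))
          ≤⟨ ∑-mono xs (λ i → exchange-pointwise (U? i) W u (value i) (<⇒≤ W<u)) ⟩
        ∑[ i ∈ xs ] ((W when u ∸ W ≤? value i when value i <? u) + (value i when u ≤? value i) + (u when U? i))
          ≡⟨ ∑-+₃ xs _ _ _ ⟩
        ∑[ i ∈ xs ] (W when u ∸ W ≤? value i when value i <? u) + ∑[ i ∈ xs ] (value i when u ≤? value i)
          + ∑[ i ∈ xs ] (u when U? i)
          ≡⟨ cong₃ (trans (∑-when-const₂ xs W (λ i → u ∸ W ≤? value i) (λ i → value i <? u))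
                          (cong (W *_) (count-window-value L u W W<u L+u≡)))
                   ∑top≡ (trans (∑-when-const xs u U?) (cong (u *_) |U|≡L)) ⟩
        W * W + (S + e) + u * L
          ≡⟨ cong (_+ u * L) (+-assoc-comm (W * W) S e) ⟩
        W * W + e + S + u * L ∎))
      where
      xs : List (Fin n)
      xs = allFin n
      small : ℕ
      small = ∑[ i ∈ xs ] (1 when value i <? u when U? i)
      |top|≡L : ∑[ i ∈ xs ] (1 when u ≤? value i) ≡ L
      |top|≡L = count-≥-value L u (≤-trans (s≤s z≤n) W<u) L+u≡
      cong₃ : ∀ {a a′ b b′ c c′} → a ≡ a′ → b ≡ b′ → c ≡ c′ → a + b + c ≡ a′ + b′ + c′
      cong₃ refl refl refl = refl
      +-assoc-comm : ∀ a b c → a + (b + c) ≡ a + c + b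
      +-assoc-comm = solve-∀

  large-pointwise : ∀ {P : Set} (d : Dec P) u h x → u ≤ h →
    (1 when h ≤? x) + (1 when d) ≤ (1 when u ≤? x) + (1 when h ≤? x when d) + (1 when x <? u when d)
  large-pointwise d u h x u≤h with h ≤? x | u ≤? x | x <? u
  ... | _       | yes u≤x | yes x<u = ⊥-elim (<-irrefl refl (<-≤-trans x<u u≤x))
  ... | _       | no u≰x  | no x≮u  = ⊥-elim (u≰x (≮⇒≥ x≮u))
  ... | yes h≤x | no u≰x  | _       = ⊥-elim (u≰x (≤-trans u≤h h≤x))
  ... | yes _   | yes _   | no _    with d
  ...   | yes _ = ≤-refl
  ...   | no _  = ≤-refl
  large-pointwise d u h x u≤h | no _ | yes _ | no _ with d
  ...   | yes _ = ≤-refl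
  ...   | no _  = z≤n
  large-pointwise d u h x u≤h | no _ | no _ | yes _ with d
  ...   | yes _ = ≤-refl
  ...   | no _  = z≤n

  block-pointwise : ∀ {P : Set} (d : Dec P) u h x → u ≤ h →
    (u when d) + (h when h ≤? x when d) ≤ (x when d) + (u when x <? u when d) + (u when h ≤? x when d)
  block-pointwise (no _)  u h x u≤h = z≤n
  block-pointwise (yes _) u h x u≤h with h ≤? x | x <? u
  ... | yes h≤x | yes x<u = ⊥-elim (<-irrefl refl (<-≤-trans x<u (≤-trans u≤h h≤x)))
  ... | yes h≤x | no _    = begin
    u + h       ≡⟨ +-comm u h ⟩
    h + u       ≤⟨ +-monoˡ-≤ u h≤x ⟩
    x + u       ≡⟨ cong (_+ u) (+-identityʳ x) ⟨
    x + 0 + u   ∎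
  ... | no _    | yes _   = begin
    u + 0       ≡⟨ +-identityʳ u ⟩
    u           ≤⟨ m≤n+m u x ⟩
    x + u       ≡⟨ +-identityʳ (x + u) ⟨
    x + u + 0   ∎
  ... | no _    | no x≮u  = +-monoˡ-≤ 0 (≤-trans (≮⇒≥ x≮u) (m≤m+n x 0))

  module _ {n : ℕ} {Q : Fin n → Set} (B? : ∀ i → Dec (Q i)) where

    private
      xs : List (Fin n)
      xs = allFin n

    large-in-block≤1 : ∀ s h → ∑[ i ∈ xs ] (value i when B? i) ≡ s → s < 2 * h →
      ∑[ i ∈ xs ] (1 when h ≤? value i when B? i) ≤ 1
    large-in-block≤1 s h ∑B≡s s<2h = ≤-pred (*-cancelʳ-< h _ 2 (begin-strict
      ∑[ i ∈ xs ] (1 when h ≤? value i when B? i) * h ≡⟨ *-comm _ h ⟩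
      h * ∑[ i ∈ xs ] (1 when h ≤? value i when B? i) ≡⟨ ∑-when-const₂ xs h (λ i → h ≤? value i) B? ⟨
      ∑[ i ∈ xs ] (h when h ≤? value i when B? i)     ≤⟨ ∑-mono xs (λ i → pointwise (B? i) (value i)) ⟩
      ∑[ i ∈ xs ] (value i when B? i)                 ≡⟨ ∑B≡s ⟩
      s                                               <⟨ s<2h ⟩
      2 * h                                           ∎))
      where
      pointwise : ∀ {P : Set} (d : Dec P) x → (h when h ≤? x when d) ≤ (x when d)
      pointwise (no _)  x = z≤n
      pointwise (yes _) x with h ≤? x
      ... | yes h≤x = h≤x
      ... | no _    = z≤n

    block-weighted : ∀ s u h sz → u ≤ h → ∑[ i ∈ xs ] (value i when B? i) ≡ s → ∑[ i ∈ xs ] (1 when B? i) ≡ sz →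
      u * sz + h * ∑[ i ∈ xs ] (1 when h ≤? value i when B? i)
        ≤ s + u * ∑[ i ∈ xs ] (1 when value i <? u when B? i) + u * ∑[ i ∈ xs ] (1 when h ≤? value i when B? i)
    block-weighted s u h sz u≤h ∑B≡s |B|≡sz = begin
      u * sz + h * large
        ≡⟨ cong₂ _+_ (trans (∑-when-const xs u B?) (cong (u *_) |B|≡sz))
                     (∑-when-const₂ xs h (λ i → h ≤? value i) B?) ⟨
      ∑[ i ∈ xs ] (u when B? i) + ∑[ i ∈ xs ] (h when h ≤? value i when B? i)
        ≡⟨ ∑-+ xs _ _ ⟨
      ∑[ i ∈ xs ] ((u when B? i) + (h when h ≤? value i when B? i))
        ≤⟨ ∑-mono xs (λ i → block-pointwise (B? i) u h (value i) u≤h) ⟩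
      ∑[ i ∈ xs ] ((value i when B? i) + (u when value i <? u when B? i) + (u when h ≤? value i when B? i))
        ≡⟨ ∑-+₃ xs _ _ _ ⟩
      ∑[ i ∈ xs ] (value i when B? i) + ∑[ i ∈ xs ] (u when value i <? u when B? i)
        + ∑[ i ∈ xs ] (u when h ≤? value i when B? i)
        ≡⟨ cong₂ (λ a b → a + b + ∑[ i ∈ xs ] (u when h ≤? value i when B? i))
                 ∑B≡s (∑-when-const₂ xs u (λ i → value i <? u) B?) ⟩
      s + u * small + ∑[ i ∈ xs ] (u when h ≤? value i when B? i)
        ≡⟨ cong (s + u * small +_) (∑-when-const₂ xs u (λ i → h ≤? value i) B?) ⟩
      s + u * small + u * large ∎
      where
      large small : ℕ
      large = ∑[ i ∈ xs ] (1 when h ≤? value i when B? i)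
      small = ∑[ i ∈ xs ] (1 when value i <? u when B? i)

    large-in-block≤small : ∀ s u h p sz → u ≤ h → s < 2 * h → s + u < p * u + h →
      ∑[ i ∈ xs ] (value i when B? i) ≡ s → ∑[ i ∈ xs ] (1 when B? i) ≡ sz → p ≤ sz →
      ∑[ i ∈ xs ] (1 when h ≤? value i when B? i) ≤ ∑[ i ∈ xs ] (1 when value i <? u when B? i)
    large-in-block≤small s u h p sz u≤h s<2h s+u<pu+h ∑B≡s |B|≡sz p≤sz = ≮⇒≥ λ small<large →
      let small≡0 : small ≡ 0
          small≡0 = n<1⇒n≡0 (<-≤-trans small<large large≤1)
          large≡1 : large ≡ 1
          large≡1 = ≤-antisym large≤1 (≤-trans (s≤s z≤n) small<large)
      in <-irrefl refl (<-≤-trans s+u<pu+h (begin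
      p * u + h             ≤⟨ +-monoˡ-≤ h (*-monoˡ-≤ u p≤sz) ⟩
      sz * u + h            ≡⟨ cong₂ _+_ (*-comm sz u) (sym (*-identityʳ h)) ⟩
      u * sz + h * 1        ≡⟨ cong (λ a → u * sz + h * a) large≡1 ⟨
      u * sz + h * large    ≤⟨ block-weighted s u h sz u≤h ∑B≡s |B|≡sz ⟩
      s + u * small + u * large ≡⟨ cong₂ (λ a b → s + u * a + u * b) small≡0 large≡1 ⟩
      s + u * 0 + u * 1     ≡⟨ cong₂ (λ a b → s + a + b) (*-zeroʳ u) (*-identityʳ u) ⟩
      s + 0 + u             ≡⟨ cong (_+ u) (+-identityʳ s) ⟩
      s + u                 ∎))
      where
      large small : ℕ
      large = ∑[ i ∈ xs ] (1 when h ≤? value i when B? i)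
      small = ∑[ i ∈ xs ] (1 when value i <? u when B? i)
      large≤1 : large ≤ 1
      large≤1 = large-in-block≤1 s h ∑B≡s s<2h

  count-< : ∀ {j J} → j ≤ J → ∑[ y < J ] (1 when y <? j) ≡ j
  count-< {j} {J} j≤J = begin-equality
    ∑[ y < J ] (1 when y <? j)                              ≡⟨ cong (λ a → ∑[ y < a ] (1 when y <? j)) (m+[n∸m]≡n j≤J) ⟨
    ∑[ y < j + (J ∸ j) ] (1 when y <? j)                    ≡⟨ ∑<-+ˡ j (J ∸ j) _ ⟩
    ∑[ y < j ] (1 when y <? j) + ∑[ x < J ∸ j ] (1 when j + x <? j)
      ≡⟨ cong₂ _+_ (∑<-cong j λ y y<j → below y<j) (∑<-cong (J ∸ j) λ x _ → above x) ⟩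
    ∑[ _ < j ] 1 + ∑[ _ < J ∸ j ] 0                          ≡⟨ cong₂ _+_ (∑<-const j 1) (∑<-const (J ∸ j) 0) ⟩
    j * 1 + (J ∸ j) * 0                                     ≡⟨ cong₂ _+_ (*-identityʳ j) (*-zeroʳ (J ∸ j)) ⟩
    j + 0                                                   ≡⟨ +-identityʳ j ⟩
    j                                                       ∎
    where
    below : ∀ {y} → y < j → (1 when y <? j) ≡ 1
    below {y} y<j with y <? j
    ... | yes _   = refl
    ... | no y≮j  = ⊥-elim (y≮j y<j)
    above : ∀ x → (1 when j + x <? j) ≡ 0
    above x with j + x <? j
    ... | yes j+x<j = ⊥-elim (<-irrefl refl (≤-<-trans (m≤m+n j x) j+x<j))
    ... | no _      = refl

  module _ {n : ℕ} (F : Fin n → ℕ) where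

    ∑-blocks : ∀ J (g : Fin n → ℕ) →
      ∑[ y < J ] ∑[ i ∈ allFin n ] (g i when F i ≟ y) ≡ ∑[ i ∈ allFin n ] (g i when F i <? J)
    ∑-blocks zero    g = sym (∑-zero (allFin n))
    ∑-blocks (suc J) g = begin-equality
      ∑[ y < J ] ∑[ i ∈ allFin n ] (g i when F i ≟ y) + ∑[ i ∈ allFin n ] (g i when F i ≟ J)
        ≡⟨ cong (_+ ∑[ i ∈ allFin n ] (g i when F i ≟ J)) (∑-blocks J g) ⟩
      ∑[ i ∈ allFin n ] (g i when F i <? J) + ∑[ i ∈ allFin n ] (g i when F i ≟ J)
        ≡⟨ ∑-+ (allFin n) _ _ ⟨
      ∑[ i ∈ allFin n ] ((g i when F i <? J) + (g i when F i ≟ J))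
        ≡⟨ ∑-cong (allFin n) (λ i → split (g i) (F i)) ⟩
      ∑[ i ∈ allFin n ] (g i when F i <? suc J) ∎
      where
      split : ∀ t a → (t when a <? J) + (t when a ≟ J) ≡ (t when a <? suc J)
      split t a with a <? J | a ≟ J | a <? suc J
      ... | yes a<J | yes refl | _         = ⊥-elim (<-irrefl refl a<J)
      ... | yes _   | no _     | yes _     = +-identityʳ t
      ... | yes a<J | no _     | no a≮1+J  = ⊥-elim (a≮1+J (m<n⇒m<1+n a<J))
      ... | no _    | yes refl | yes _     = refl
      ... | no _    | yes refl | no J≮1+J  = ⊥-elim (J≮1+J ≤-refl)
      ... | no a≮J  | no a≢J   | yes a<1+J = ⊥-elim (a≢J (≤-antisym (≤-pred a<1+J) (≮⇒≥ a≮J)))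
      ... | no _    | no _     | no _      = refl

  module _ {n : ℕ} {P : Fin n → Set} (U? : ∀ i → Dec (P i)) where

    large-count : ∀ L u h X → 1 ≤ u → u ≤ h → L + u ≡ suc n → X + h ≡ suc n →
      ∑[ i ∈ allFin n ] (1 when U? i) ≡ L →
      X ≤ ∑[ i ∈ allFin n ] (1 when h ≤? value i when U? i) + ∑[ i ∈ allFin n ] (1 when value i <? u when U? i)
    large-count L u h X 1≤u u≤h L+u≡ X+h≡ |U|≡L = +-cancelˡ-≤ L _ _ (begin
      L + X
        ≡⟨ +-comm L X ⟩
      X + L
        ≡⟨ cong₂ _+_ (count-≥-value X h (≤-trans 1≤u u≤h) X+h≡) |U|≡L ⟨
      ∑[ i ∈ xs ] (1 when h ≤? value i) + ∑[ i ∈ xs ] (1 when U? i)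
        ≡⟨ ∑-+ xs _ _ ⟨
      ∑[ i ∈ xs ] ((1 when h ≤? value i) + (1 when U? i))
        ≤⟨ ∑-mono xs (λ i → large-pointwise (U? i) u h (value i) u≤h) ⟩
      ∑[ i ∈ xs ] ((1 when u ≤? value i) + (1 when h ≤? value i when U? i) + (1 when value i <? u when U? i))
        ≡⟨ ∑-+₃ xs _ _ _ ⟩
      ∑[ i ∈ xs ] (1 when u ≤? value i) + ∑[ i ∈ xs ] (1 when h ≤? value i when U? i)
        + ∑[ i ∈ xs ] (1 when value i <? u when U? i)
        ≡⟨ cong (λ a → a + _ + _) (count-≥-value L u 1≤u L+u≡) ⟩
      L + ∑[ i ∈ xs ] (1 when h ≤? value i when U? i) + ∑[ i ∈ xs ] (1 when value i <? u when U? i)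
        ≡⟨ +-assoc L _ _ ⟩
      L + (∑[ i ∈ xs ] (1 when h ≤? value i when U? i) + ∑[ i ∈ xs ] (1 when value i <? u when U? i)) ∎)
      where
      xs : List (Fin n)
      xs = allFin n

  module _ {n s J j p L e u h W X : ℕ}
    (j≤J : j ≤ J) (L+u≡ : L + u ≡ suc n) (u≤h : u ≤ h) (W<u : W < u) (X+h≡ : X + h ≡ suc n)
    (s<2h : s < 2 * h) (s+u<pu+h : s + u < p * u + h) (margin : W * j + 2 * (W * W + e) < W * X) where

    no-packing : (F : Fin n → ℕ) (sz : ℕ → ℕ) →
      (∀ y → y < J → ∑[ i ∈ allFin n ] (value i when F i ≟ y) ≡ s) →
      (∀ y → y < J → ∑[ i ∈ allFin n ] (1 when F i ≟ y) ≡ sz y) →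
      ∑< J sz ≡ L → (∀ y → j ≤ y → y < J → p ≤ sz y) →
      ∑[ i ∈ allFin n ] (value i when u ≤? value i) ≡ J * s + e → ⊥
    no-packing F sz ∑block≡s |block|≡sz ∑sz≡L p≤sz ∑top≡ = <-irrefl refl (<-≤-trans margin (begin
      W * X                    ≤⟨ *-monoʳ-≤ W X≤j+d+d ⟩
      W * (j + d + d)          ≡⟨ distrib W j d ⟩
      W * j + 2 * (W * d)      ≤⟨ +-monoʳ-≤ (W * j) (*-monoʳ-≤ 2 Wd≤WW+e) ⟩
      W * j + 2 * (W * W + e)  ∎))
      where
      xs : List (Fin n)
      xs = allFin n
      U? : ∀ i → Dec (F i < J)
      U? i = F i <? J
      d large : ℕ
      d     = ∑[ i ∈ xs ] (1 when value i <? u when U? i)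
      large = ∑[ i ∈ xs ] (1 when h ≤? value i when U? i)
      distrib : ∀ W j d → W * (j + d + d) ≡ W * j + 2 * (W * d)
      distrib = solve-∀
      |U|≡L : ∑[ i ∈ xs ] (1 when U? i) ≡ L
      |U|≡L = trans (sym (∑-blocks F J (λ _ → 1))) (trans (∑<-cong J |block|≡sz) ∑sz≡L)
      ∑U≡Js : ∑[ i ∈ xs ] (value i when U? i) ≡ J * s
      ∑U≡Js = trans (sym (∑-blocks F J value)) (trans (∑<-cong J ∑block≡s) (∑<-const J s))
      Wd≤WW+e : W * d ≤ W * W + e
      Wd≤WW+e = exchange-bound U? L u W (J * s) e W<u L+u≡ |U|≡L ∑U≡Js ∑top≡
      large-per-block : ∀ y → y < J →
        ∑[ i ∈ xs ] (1 when h ≤? value i when F i ≟ y) ≤ (1 when y <? j) + ∑[ i ∈ xs ] (1 when value i <? u when F i ≟ y)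
      large-per-block y y<J with y <? j
      ... | yes _   = ≤-trans (large-in-block≤1 (λ i → F i ≟ y) s h (∑block≡s y y<J) s<2h) (m≤m+n 1 _)
      ... | no y≮j  = large-in-block≤small (λ i → F i ≟ y) s u h p (sz y) u≤h s<2h s+u<pu+h
                        (∑block≡s y y<J) (|block|≡sz y y<J) (p≤sz y (≮⇒≥ y≮j) y<J)
      large≤j+d : large ≤ j + d
      large≤j+d = begin
        large                                                        ≡⟨ ∑-blocks F J _ ⟨
        ∑[ y < J ] ∑[ i ∈ xs ] (1 when h ≤? value i when F i ≟ y)    ≤⟨ ∑<-mono J large-per-block ⟩
        ∑[ y < J ] ((1 when y <? j) + ∑[ i ∈ xs ] (1 when value i <? u when F i ≟ y)) ≡⟨ ∑<-+ J _ _ ⟩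
        ∑[ y < J ] (1 when y <? j) + ∑[ y < J ] ∑[ i ∈ xs ] (1 when value i <? u when F i ≟ y)
          ≡⟨ cong₂ _+_ (count-< j≤J) (∑-blocks F J _) ⟩
        j + d                                                        ∎
      X≤j+d+d : X ≤ j + d + d
      X≤j+d+d = ≤-trans (large-count U? L u h X (≤-trans (s≤s z≤n) W<u) u≤h L+u≡ X+h≡ |U|≡L)
                        (+-monoˡ-≤ d large≤j+d)

module RunInstances where

  open import Defs
  open FiniteSums
  open Exchange
  open import Data.Empty using (⊥-elim)
  open import Data.Product using (_×_; _,_; proj₁; proj₂)
  open import Data.Fin as Fin using (Fin; toℕ)
  import Data.Fin.Properties as Fin
  open import Data.List as List using (List; []; _∷_; allFin; applyUpTo; take; upTo)
  open import Data.List.Properties using (map-applyUpTo)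
  open import Data.List.Relation.Unary.All using (All; []; _∷_)
  open import Data.List.Relation.Unary.AllPairs using (AllPairs; []; _∷_)
  open import Data.List.Relation.Unary.Linked using (Linked)
  open import Data.List.Relation.Unary.Linked.Properties using (Linked⇒AllPairs)
  open import Data.Unit using (⊤)
  open import Data.Nat using (ℕ; zero; suc; _+_; _*_; _∸_; _≤_; _<_; z≤n; s≤s; _≟_; _≤?_; _<?_; NonZero; >-nonZero)
  open import Data.Nat.DivMod using (_/_; m*n/n≡m)
  open import Data.Nat.Divisibility using (divides)
  open import Data.Integer using (+≤+)
  open import Data.Integer.Properties using (i≤j⇒0≤j-i)
  import Data.Vec.Properties as Vec
  open import Data.Nat.ListAction using (sum)
  open import Data.Nat.Properties
  open import Data.Nat.Tactic.RingSolver using (solve-∀)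
  open import Data.Vec as Vec using (Vec; toList; lookup)
  open import Function using (_∘_)
  open import Relation.Binary.PropositionalEquality
  open import Relation.Nullary using (yes; no; ¬_)

  open ≤-Reasoning

  module _ {n k : ℕ} (f : Fin n → Fin k) (ℓ : Fin k) where

    private
      when-toℕ : ∀ t (a : Fin k) → (t when a Fin.≟ ℓ) ≡ (t when toℕ a ≟ toℕ ℓ)
      when-toℕ t a with a Fin.≟ ℓ | toℕ a ≟ toℕ ℓ
      ... | yes _    | yes _ = refl
      ... | no _     | no _  = refl
      ... | yes refl | no ≢ℓ  = ⊥-elim (≢ℓ refl)
      ... | no ≢ℓ    | yes ≡ℓ = ⊥-elim (≢ℓ (Fin.toℕ-injective ≡ℓ))

    blockSize≡∑ : blockSize f ℓ ≡ ∑[ i ∈ allFin n ] (1 when toℕ (f i) ≟ toℕ ℓ)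
    blockSize≡∑ = trans (length-filter≡∑when (λ i → f i Fin.≟ ℓ) (allFin n))
                        (∑-cong (allFin n) (λ i → when-toℕ 1 (f i)))

    blockSum≡∑ : blockSum f ℓ ≡ ∑[ i ∈ allFin n ] (value i when toℕ (f i) ≟ toℕ ℓ)
    blockSum≡∑ = trans (sum-filter≡∑when (λ i → f i Fin.≟ ℓ) (allFin n) value)
                       (∑-cong (allFin n) (λ i → when-toℕ (value i) (f i)))

  topSum-suc : ∀ n m → topSum n (suc m) ≡ topSum n m + (n ∸ m)
  topSum-suc n m = begin-equality
    sum (List.map (n ∸_) (upTo (suc m)))  ≡⟨ cong sum (map-applyUpTo (λ i → i) (n ∸_) (suc m)) ⟩
    sum (applyUpTo (n ∸_) (suc m))        ≡⟨ ∑-applyUpTo (suc m) (n ∸_) ⟩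
    ∑< m (n ∸_) + (n ∸ m)                 ≡⟨ cong (_+ (n ∸ m)) (∑-applyUpTo m (n ∸_)) ⟨
    sum (applyUpTo (n ∸_) m) + (n ∸ m)    ≡⟨ cong (λ xs → sum xs + (n ∸ m)) (map-applyUpTo (λ i → i) (n ∸_) m) ⟨
    topSum n m + (n ∸ m)                  ∎

  topSum-closed : ∀ {n m} → m ≤ n → 2 * topSum n m + m * m ≡ 2 * m * n + m
  topSum-closed {n} {zero}  _   = refl
  topSum-closed {n} {suc m} m<n = begin-equality
    2 * topSum n (suc m) + suc m * suc m          ≡⟨ cong (λ t → 2 * t + suc m * suc m) (topSum-suc n m) ⟩
    2 * (topSum n m + (n ∸ m)) + suc m * suc m    ≡⟨ regroup (topSum n m) (n ∸ m) m ⟩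
    (2 * topSum n m + m * m) + 2 * (n ∸ m + m) + 1 ≡⟨ cong₂ (λ a b → a + 2 * b + 1) (topSum-closed (<⇒≤ m<n)) (m∸n+n≡m (<⇒≤ m<n)) ⟩
    2 * m * n + m + 2 * n + 1                     ≡⟨ regroup′ m n ⟩
    2 * suc m * n + suc m                         ∎
    where
    regroup : ∀ t d m → 2 * (t + d) + suc m * suc m ≡ (2 * t + m * m) + 2 * (d + m) + 1
    regroup = solve-∀
    regroup′ : ∀ m n → 2 * m * n + m + 2 * n + 1 ≡ 2 * suc m * n + suc m
    regroup′ = solve-∀

  ∑-top≡topSum : ∀ n u L → L + u ≡ n → ∑[ x < n ] (suc x when suc u ≤? suc x) ≡ topSum n L
  ∑-top≡topSum zero    u zero    _  = refl
  ∑-top≡topSum (suc n) u zero    refl = begin-equality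
    ∑[ x < suc n ] (suc x when suc (suc n) ≤? suc x) ≡⟨ ∑<-cong (suc n) (λ x x<1+n → absent x<1+n) ⟩
    ∑[ _ < suc n ] 0                                 ≡⟨ ∑<-const (suc n) 0 ⟩
    suc n * 0                                        ≡⟨ *-zeroʳ (suc n) ⟩
    0                                                ∎
    where
    absent : ∀ {x} → x < suc n → (suc x when suc (suc n) ≤? suc x) ≡ 0
    absent {x} x<1+n with suc (suc n) ≤? suc x
    ... | yes 2+n≤1+x = ⊥-elim (<-irrefl refl (<-≤-trans x<1+n (≤-pred 2+n≤1+x)))
    ... | no _        = refl
  ∑-top≡topSum (suc n) u (suc L) L+u≡ = begin-equality
    ∑[ x < n ] (suc x when suc u ≤? suc x) + (suc n when suc u ≤? suc n)
      ≡⟨ cong₂ _+_ (∑-top≡topSum n u L (suc-injective L+u≡)) present ⟩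
    topSum n L + suc n                                 ≡⟨ +-comm (topSum n L) (suc n) ⟩
    suc n + topSum n L                                 ≡⟨ topSum-head n L ⟨
    topSum (suc n) (suc L)                             ∎
    where
    present : (suc n when suc u ≤? suc n) ≡ suc n
    present with suc u ≤? suc n
    ... | yes _   = refl
    ... | no 1+u≰1+n = ⊥-elim (1+u≰1+n (s≤s (≤-trans (m≤n+m u L) (≤-reflexive (suc-injective L+u≡)))))
    topSum-head : ∀ n L → topSum (suc n) (suc L) ≡ suc n + topSum n L
    topSum-head n zero    = refl
    topSum-head n (suc L) = begin-equality
      topSum (suc n) (suc (suc L))             ≡⟨ topSum-suc (suc n) (suc L) ⟩
      topSum (suc n) (suc L) + (n ∸ L)         ≡⟨ cong (_+ (n ∸ L)) (topSum-head n L) ⟩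
      suc n + topSum n L + (n ∸ L)             ≡⟨ +-assoc (suc n) _ _ ⟩
      suc n + (topSum n L + (n ∸ L))           ≡⟨ cong (suc n +_) (topSum-suc n L) ⟨
      suc n + topSum n (suc L)                 ∎

  ∑-top-value≡topSum : ∀ {n u L} → 1 ≤ u → L + u ≡ suc n →
    ∑[ i ∈ allFin n ] (value i when u ≤? value i) ≡ topSum n L
  ∑-top-value≡topSum {n} {suc u} {L} _ L+u≡ =
    trans (∑-allFin n (λ x → suc x when suc u ≤? suc x))
          (∑-top≡topSum n u L (suc-injective (trans (sym (+-suc L u)) L+u≡)))

  -- a composition written as runs (multiplicity , part)
  Runs : Set
  Runs = List (ℕ × ℕ)

  count total : Runs → ℕ
  count []             = 0
  count ((a , _) ∷ rs) = a + count rs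
  total []             = 0
  total ((a , c) ∷ rs) = c * a + total rs

  -- the part at position y, counting from 0; junk value 0 past the end
  part : Runs → ℕ → ℕ
  part []             _ = 0
  part ((a , c) ∷ rs) y with y <? a
  ... | yes _ = c
  ... | no _  = part rs (y ∸ a)

  module _ {a c : ℕ} {rs : Runs} where

    part-head : ∀ {y} → y < a → part ((a , c) ∷ rs) y ≡ c
    part-head {y} y<a with y <? a
    ... | yes _   = refl
    ... | no y≮a  = ⊥-elim (y≮a y<a)

    part-tail : ∀ y → part ((a , c) ∷ rs) (a + y) ≡ part rs y
    part-tail y with a + y <? a
    ... | yes a+y<a = ⊥-elim (<-irrefl refl (≤-<-trans (m≤m+n a y) a+y<a))
    ... | no _      = cong (part rs) (m+n∸m≡n a y)

    ∑<-part-head : ∀ {M} → M ≤ a → ∑[ y < M ] part ((a , c) ∷ rs) y ≡ c * M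
    ∑<-part-head {M} M≤a = begin-equality
      ∑[ y < M ] part ((a , c) ∷ rs) y  ≡⟨ ∑<-cong M (λ y y<M → part-head (<-≤-trans y<M M≤a)) ⟩
      ∑[ _ < M ] c                      ≡⟨ ∑<-const M c ⟩
      M * c                             ≡⟨ *-comm M c ⟩
      c * M                             ∎

    ∑<-part-tail : ∀ M → ∑[ y < a + M ] part ((a , c) ∷ rs) y ≡ c * a + ∑[ y < M ] part rs y
    ∑<-part-tail M = begin-equality
      ∑[ y < a + M ] part ((a , c) ∷ rs) y                        ≡⟨ ∑<-+ˡ a M _ ⟩
      ∑[ y < a ] part ((a , c) ∷ rs) y + ∑[ x < M ] part ((a , c) ∷ rs) (a + x)
        ≡⟨ cong₂ _+_ (∑<-part-head ≤-refl) (∑<-cong M (λ x _ → part-tail x)) ⟩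
      c * a + ∑[ y < M ] part rs y                                ∎

  ∑<-part-count : ∀ rs → ∑[ y < count rs ] part rs y ≡ total rs
  ∑<-part-count []             = refl
  ∑<-part-count ((a , c) ∷ rs) = trans (∑<-part-tail {a} {c} {rs} (count rs)) (cong (c * a +_) (∑<-part-count rs))

  private
    index-in-tail : ∀ {a y m} → ¬ y < a → y < a + m → y ∸ a < m
    index-in-tail {a} {y} {m} y≮a y<a+m = subst (y ∸ a <_) (m+n∸m≡n a m) (∸-monoˡ-< y<a+m (≮⇒≥ y≮a))

  part-lower : ∀ {c rs y} → All (λ r → c ≤ proj₂ r) rs → y < count rs → c ≤ part rs y
  part-lower {c} {(a , c′) ∷ rs} {y} (c≤c′ ∷ c≤rs) y<count with y <? a
  ... | yes _   = c≤c′
  ... | no y≮a  = part-lower c≤rs (index-in-tail y≮a y<count)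

  _≤ₚ_ : ℕ × ℕ → ℕ × ℕ → Set
  r ≤ₚ r′ = proj₂ r ≤ proj₂ r′

  part-mono : ∀ {rs y y′} → AllPairs _≤ₚ_ rs → y ≤ y′ → y′ < count rs → part rs y ≤ part rs y′
  part-mono {(a , c) ∷ rs} {y} {y′} (c≤rs ∷ sorted) y≤y′ y′<count with y <? a | y′ <? a
  ... | yes _   | yes _    = ≤-refl
  ... | yes _   | no y′≮a  = part-lower c≤rs (index-in-tail y′≮a y′<count)
  ... | no y≮a  | yes y′<a = ⊥-elim (y≮a (≤-<-trans y≤y′ y′<a))
  ... | no y≮a  | no y′≮a  = part-mono sorted (∸-monoˡ-≤ a y≤y′) (index-in-tail y′≮a y′<count)

  -- B blocks of sum s fit under the Q largest numbers, B · s ≤ topSum n Q, written without subtraction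
  SlackAt : (n s B Q : ℕ) → Set
  SlackAt n s B Q = 2 * B * s + Q * Q ≤ 2 * Q * n + Q

  slack-criterion : ∀ {n s B Q} → Q ≤ n → SlackAt n s B Q → B * s ≤ topSum n Q
  slack-criterion {n} {s} {B} {Q} Q≤n slack = *-cancelˡ-≤ 2 (+-cancelʳ-≤ (Q * Q) _ _ (begin
    2 * (B * s) + Q * Q      ≡⟨ cong (_+ Q * Q) (*-assoc 2 B s) ⟨
    2 * B * s + Q * Q        ≤⟨ slack ⟩
    2 * Q * n + Q            ≡⟨ topSum-closed Q≤n ⟨
    2 * topSum n Q + Q * Q   ∎))

  slack-concave : ∀ {n s B Q} c {a} i → i ≤ a →
    SlackAt n s B Q → SlackAt n s (B + a) (Q + c * a) → SlackAt n s (B + i) (Q + c * i)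
  slack-concave {n} {s} {B} {Q} c {a} i i≤a slack₀ slackₐ =
    chord i (a ∸ i) (subst₂ (SlackAt n s) (sym (+-identityʳ B)) (sym Q+c*0≡Q) slack₀)
                    (subst (λ t → SlackAt n s (B + t) (Q + c * t)) (sym (m+[n∸m]≡n i≤a)) slackₐ)
    where
    Q+c*0≡Q : Q + c * 0 ≡ Q
    Q+c*0≡Q = trans (cong (Q +_) (*-zeroʳ c)) (+-identityʳ Q)
    lhs rhs : ℕ → ℕ
    lhs t = 2 * (B + t) * s + (Q + c * t) * (Q + c * t)
    rhs t = 2 * (Q + c * t) * n + (Q + c * t)
    -- lhs − rhs is convex in t (leading coefficient c²), so it lies below its chord
    chord-identity : ∀ i r → (i + r) * rhs i + r * lhs 0 + i * lhs (i + r)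
                           ≡ (i + r) * lhs i + (r * rhs 0 + i * rhs (i + r) + c * c * i * r * (i + r))
    chord-identity i r = identity n s B Q c i r
      where
      identity : ∀ n s B Q c i r →
        (i + r) * (2 * (Q + c * i) * n + (Q + c * i))
          + r * (2 * (B + 0) * s + (Q + c * 0) * (Q + c * 0))
          + i * (2 * (B + (i + r)) * s + (Q + c * (i + r)) * (Q + c * (i + r)))
        ≡ (i + r) * (2 * (B + i) * s + (Q + c * i) * (Q + c * i))
          + (r * (2 * (Q + c * 0) * n + (Q + c * 0)) + i * (2 * (Q + c * (i + r)) * n + (Q + c * (i + r)))
             + c * c * i * r * (i + r))
      identity = solve-∀
    chord : ∀ i r → lhs 0 ≤ rhs 0 → lhs (i + r) ≤ rhs (i + r) → lhs i ≤ rhs i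
    chord zero    r ok₀ _   = ok₀
    chord (suc i) r ok₀ okₐ = *-cancelˡ-≤ (suc i + r) (+-cancelʳ-≤ extra _ _ (begin
      (suc i + r) * lhs (suc i) + extra                              ≡⟨ chord-identity (suc i) r ⟨
      (suc i + r) * rhs (suc i) + r * lhs 0 + suc i * lhs (suc i + r) ≤⟨ +-mono-≤ (+-monoʳ-≤ ((suc i + r) * rhs (suc i)) (*-monoʳ-≤ r ok₀))
                                                                                  (*-monoʳ-≤ (suc i) okₐ) ⟩
      (suc i + r) * rhs (suc i) + r * rhs 0 + suc i * rhs (suc i + r) ≡⟨ +-assoc ((suc i + r) * rhs (suc i)) _ _ ⟩
      (suc i + r) * rhs (suc i) + (r * rhs 0 + suc i * rhs (suc i + r)) ≤⟨ +-monoʳ-≤ ((suc i + r) * rhs (suc i)) (m≤m+n _ _) ⟩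
      (suc i + r) * rhs (suc i) + extra                              ∎))
      where
      extra : ℕ
      extra = r * rhs 0 + suc i * rhs (suc i + r) + c * c * suc i * r * (suc i + r)

  BoundarySlack : (n s : ℕ) → Runs → (B Q : ℕ) → Set
  BoundarySlack n s []             B Q = ⊤
  BoundarySlack n s ((a , c) ∷ rs) B Q =
    SlackAt n s (B + a) (Q + c * a) × BoundarySlack n s rs (B + a) (Q + c * a)

  runs-slack : ∀ {n s} rs {B Q} → SlackAt n s B Q → BoundarySlack n s rs B Q →
    ∀ M → M ≤ count rs → SlackAt n s (B + M) (Q + ∑[ y < M ] part rs y)
  runs-slack {n} {s} [] {B} {Q} slack _ zero _ =
    subst₂ (SlackAt n s) (sym (+-identityʳ B)) (sym (+-identityʳ Q)) slack
  runs-slack {n} {s} ((a , c) ∷ rs) {B} {Q} slack (slackₐ , boundaries) M M≤count with M ≤? a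
  ... | yes M≤a = subst (λ t → SlackAt n s (B + M) (Q + t)) (sym (∑<-part-head M≤a))
                    (slack-concave {n} {s} {B} {Q} c M M≤a slack slackₐ)
  ... | no M≰a  = subst₂ (SlackAt n s) B-shift Q-shift
                    (runs-slack {n} {s} rs {B + a} {Q + c * a} slackₐ boundaries (M ∸ a) (∸-monoˡ-≤′ M≤count))
    where
    a≤M : a ≤ M
    a≤M = <⇒≤ (≰⇒> M≰a)
    ∸-monoˡ-≤′ : M ≤ a + count rs → M ∸ a ≤ count rs
    ∸-monoˡ-≤′ M≤ = subst (M ∸ a ≤_) (m+n∸m≡n a (count rs)) (∸-monoˡ-≤ a M≤)
    B-shift : B + a + (M ∸ a) ≡ B + M
    B-shift = trans (+-assoc B a (M ∸ a)) (cong (B +_) (m+[n∸m]≡n a≤M))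
    Q-shift : Q + c * a + ∑[ y < M ∸ a ] part rs y ≡ Q + ∑[ y < M ] part ((a , c) ∷ rs) y
    Q-shift = begin-equality
      Q + c * a + ∑[ y < M ∸ a ] part rs y                 ≡⟨ +-assoc Q (c * a) _ ⟩
      Q + (c * a + ∑[ y < M ∸ a ] part rs y)               ≡⟨ cong (Q +_) (∑<-part-tail {a} {c} {rs} (M ∸ a)) ⟨
      Q + ∑[ y < a + (M ∸ a) ] part ((a , c) ∷ rs) y       ≡⟨ cong (λ t → Q + ∑[ y < t ] part ((a , c) ∷ rs) y) (m+[n∸m]≡n a≤M) ⟩
      Q + ∑[ y < M ] part ((a , c) ∷ rs) y                 ∎

  slack-before-run : ∀ {n s B Q a β w e} → n ≡ Q + β + w →
    2 * ((B + a) * s + e) + (Q + β) * (Q + β) ≡ 2 * (Q + β) * n + (Q + β) →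
    β * (β + 2 * w + 1) ≤ 2 * a * s → SlackAt n s B Q
  slack-before-run {n} {s} {B} {Q} {a} {β} {w} {e} refl exact β-small =
    +-cancelʳ-≤ (2 * a * s + 2 * e) _ _ (begin
      2 * B * s + Q * Q + (2 * a * s + 2 * e)          ≡⟨ +-cancelʳ-≡ (2 * Q * β + β * β) _ _ expanded ⟩
      2 * Q * n + Q + β * (β + 2 * w + 1)              ≤⟨ +-monoʳ-≤ (2 * Q * n + Q) (≤-trans β-small (m≤m+n (2 * a * s) (2 * e))) ⟩
      2 * Q * n + Q + (2 * a * s + 2 * e)              ∎)
    where
    expanded : 2 * B * s + Q * Q + (2 * a * s + 2 * e) + (2 * Q * β + β * β)
             ≡ 2 * Q * n + Q + β * (β + 2 * w + 1) + (2 * Q * β + β * β)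
    expanded = begin-equality
      2 * B * s + Q * Q + (2 * a * s + 2 * e) + (2 * Q * β + β * β)  ≡⟨ eq₁ B Q a β s e ⟩
      2 * ((B + a) * s + e) + (Q + β) * (Q + β)                      ≡⟨ exact ⟩
      2 * (Q + β) * (Q + β + w) + (Q + β)                            ≡⟨ eq₂ Q β w ⟩
      2 * Q * (Q + β + w) + Q + β * (β + 2 * w + 1) + (2 * Q * β + β * β) ∎
      where
      eq₁ : ∀ B Q a β s e → 2 * B * s + Q * Q + (2 * a * s + 2 * e) + (2 * Q * β + β * β)
                          ≡ 2 * ((B + a) * s + e) + (Q + β) * (Q + β)
      eq₁ = solve-∀
      eq₂ : ∀ Q β w → 2 * (Q + β) * (Q + β + w) + (Q + β)
                    ≡ 2 * Q * (Q + β + w) + Q + β * (β + 2 * w + 1) + (2 * Q * β + β * β)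
      eq₂ = solve-∀

  toList-tabulate : ∀ {A : Set} k (f : Fin k → A) → toList (Vec.tabulate f) ≡ List.tabulate f
  toList-tabulate zero    f = refl
  toList-tabulate (suc k) f = cong (f Fin.zero ∷_) (toList-tabulate k (f ∘ Fin.suc))

  take-applyUpTo : ∀ {A : Set} (f : ℕ → A) {M k} → M ≤ k → take M (applyUpTo f k) ≡ applyUpTo f M
  take-applyUpTo f {zero}  _         = refl
  take-applyUpTo f {suc M} (s≤s M≤k) = cong (f 0 ∷_) (take-applyUpTo (f ∘ suc) M≤k)

  module RunInstance (n s : ℕ) (rs : Runs) (1≤n : 1 ≤ n) (1≤k : 1 ≤ count rs)
    (2ks≡ : 2 * count rs * s ≡ n * suc n) (total≡n : total rs ≡ n)
    (positive : All (λ r → 1 ≤ proj₂ r) rs) (sorted : Linked _≤ₚ_ rs)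
    (boundaries : BoundarySlack n s rs 0 0) where

    k : ℕ
    k = count rs

    instance
      k≢0 : NonZero k
      k≢0 = >-nonZero 1≤k

    P : Vec ℕ k
    P = Vec.tabulate (part rs ∘ toℕ)

    tri≡ks : tri n ≡ k * s
    tri≡ks = begin-equality
      n * suc n / 2    ≡⟨ cong (_/ 2) 2ks≡ ⟨
      2 * k * s / 2    ≡⟨ cong (_/ 2) (*-comm-2 k s) ⟩
      k * s * 2 / 2    ≡⟨ m*n/n≡m (k * s) 2 ⟩
      k * s            ∎
      where
      *-comm-2 : ∀ k s → 2 * k * s ≡ k * s * 2
      *-comm-2 = solve-∀

    sNK≡s : sNK n k ≡ s
    sNK≡s = trans (cong (_/ k) (trans tri≡ks (*-comm k s))) (m*n/n≡m s k)

    toList-P : toList P ≡ applyUpTo (part rs) k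
    toList-P = trans (toList-tabulate k _) (tabulate-toℕ k (part rs))

    prefixSum≡∑< : ∀ {M} → M ≤ k → prefixSum P M ≡ ∑[ y < M ] part rs y
    prefixSum≡∑< {M} M≤k = begin-equality
      sum (take M (toList P))              ≡⟨ cong (sum ∘ take M) toList-P ⟩
      sum (take M (applyUpTo (part rs) k)) ≡⟨ cong sum (take-applyUpTo (part rs) M≤k) ⟩
      sum (applyUpTo (part rs) M)          ≡⟨ ∑-applyUpTo M (part rs) ⟩
      ∑[ y < M ] part rs y                 ∎

    lookup-P : ∀ ℓ → lookup P ℓ ≡ part rs (toℕ ℓ)
    lookup-P = Vec.lookup∘tabulate (part rs ∘ toℕ)

    composition : IsNonDescComposition n k P
    composition =
        (λ ℓ → subst (1 ≤_) (sym (lookup-P ℓ)) (part-lower positive (Fin.toℕ<n ℓ)))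
      , (λ ℓ ℓ′ ℓ≤ℓ′ → subst₂ _≤_ (sym (lookup-P ℓ)) (sym (lookup-P ℓ′))
                         (part-mono (Linked⇒AllPairs ≤-trans sorted) ℓ≤ℓ′ (Fin.toℕ<n ℓ′)))
      , (begin-equality
          sum (toList P)               ≡⟨ cong sum toList-P ⟩
          sum (applyUpTo (part rs) k)  ≡⟨ ∑-applyUpTo k (part rs) ⟩
          ∑[ y < k ] part rs y         ≡⟨ ∑<-part-count rs ⟩
          total rs                     ≡⟨ total≡n ⟩
          n                            ∎)

    slackNonNeg : SlackNonNeg n k P
    slackNonNeg M _ M<k = i≤j⇒0≤j-i (+≤+ (subst₂ _≤_ (cong (M *_) (sym sNK≡s)) (cong (topSum n) (sym (prefixSum≡∑< M≤k)))
                            (slack-criterion {n} {s} {M} prefix≤n (runs-slack {n} {s} rs {0} {0} ≤-refl boundaries M M≤k))))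
      where
      M≤k : M ≤ k
      M≤k = <⇒≤ M<k
      prefix≤n : ∑[ y < M ] part rs y ≤ n
      prefix≤n = begin
        ∑[ y < M ] part rs y                              ≤⟨ m≤m+n _ _ ⟩
        ∑[ y < M ] part rs y + ∑[ x < k ∸ M ] part rs (M + x) ≡⟨ ∑<-+ˡ M (k ∸ M) (part rs) ⟨
        ∑[ y < M + (k ∸ M) ] part rs y                    ≡⟨ cong (λ t → ∑[ y < t ] part rs y) (m+[n∸m]≡n M≤k) ⟩
        ∑[ y < k ] part rs y                              ≡⟨ ∑<-part-count rs ⟩
        total rs                                          ≡⟨ total≡n ⟩
        n                                                 ∎

    espp : ESPP
    espp = record
      { n = n ; k = k ; n-pos = 1≤n ; k-pos = 1≤k
      ; k∣tri = divides s (trans tri≡ks (*-comm k s))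
      ; P = P ; P-comp = composition ; P-slack = slackNonNeg }

    not-solvable : ∀ {j J L e u h W X p} → j ≤ J → J ≤ k → ∑[ y < J ] part rs y ≡ L →
      (∀ y → j ≤ y → y < J → p ≤ part rs y) → J * s + e ≡ topSum n L →
      L + u ≡ suc n → u ≤ h → W < u → X + h ≡ suc n → s < 2 * h → s + u < p * u + h →
      W * j + 2 * (W * W + e) < W * X → ¬ Solvable espp
    not-solvable {j} {J} {L} {e} {u} {h} {W} {X} {p} j≤J J≤k ∑part≡L p≤part top≡ L+u≡ u≤h W<u X+h≡ s<2h s+u<pu+h margin
                 (f , f-solves) =
      no-packing j≤J L+u≡ u≤h W<u X+h≡ s<2h s+u<pu+h margin (toℕ ∘ f) (part rs)
                 block-sum block-size ∑part≡L p≤part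
                 (trans (∑-top-value≡topSum (≤-trans (s≤s z≤n) W<u) L+u≡) (sym top≡))
      where
      label : ∀ {y} → y < J → Fin k
      label y<J = Fin.fromℕ< (<-≤-trans y<J J≤k)
      toℕ-label : ∀ {y} (y<J : y < J) → toℕ (label y<J) ≡ y
      toℕ-label y<J = Fin.toℕ-fromℕ< (<-≤-trans y<J J≤k)
      block-sum : ∀ y → y < J → ∑[ i ∈ allFin n ] (value i when toℕ (f i) ≟ y) ≡ s
      block-sum y y<J = begin-equality
        ∑[ i ∈ allFin n ] (value i when toℕ (f i) ≟ y)
          ≡⟨ cong (λ t → ∑[ i ∈ allFin n ] (value i when toℕ (f i) ≟ t)) (toℕ-label y<J) ⟨
        ∑[ i ∈ allFin n ] (value i when toℕ (f i) ≟ toℕ (label y<J))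
          ≡⟨ blockSum≡∑ f (label y<J) ⟨
        blockSum f (label y<J)   ≡⟨ proj₂ (f-solves (label y<J)) ⟩
        sNK n k                  ≡⟨ sNK≡s ⟩
        s                        ∎
      block-size : ∀ y → y < J → ∑[ i ∈ allFin n ] (1 when toℕ (f i) ≟ y) ≡ part rs y
      block-size y y<J = begin-equality
        ∑[ i ∈ allFin n ] (1 when toℕ (f i) ≟ y)
          ≡⟨ cong (λ t → ∑[ i ∈ allFin n ] (1 when toℕ (f i) ≟ t)) (toℕ-label y<J) ⟨
        ∑[ i ∈ allFin n ] (1 when toℕ (f i) ≟ toℕ (label y<J))
          ≡⟨ blockSize≡∑ f (label y<J) ⟨
        blockSize f (label y<J)      ≡⟨ proj₁ (f-solves (label y<J)) ⟩
        lookup P (label y<J)         ≡⟨ lookup-P (label y<J) ⟩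
        part rs (toℕ (label y<J))    ≡⟨ cong (part rs) (toℕ-label y<J) ⟩
        part rs y                    ∎

module Arithmetic where

  open import Data.Empty using (⊥; ⊥-elim)
  open import Data.Integer as ℤ using (+_; -[1+_])
  import Data.Integer.Properties as ℤ
  open import Data.Nat using (ℕ; zero; suc; _+_; _*_; _∸_; _≤_; _<_; z≤n; s≤s; NonZero; >-nonZero)
  open import Data.Nat.DivMod using (_/_; _%_; m≡m%n+[m/n]*n; m%n<n; m/n*n≤m)
  open import Data.Nat.Coprimality using (Coprime; coprime?; coprime-Bézout)
  open import Data.Nat.GCD using (module Bézout)
  open import Data.Nat.Properties
  open import Data.Nat.Tactic.RingSolver using (solve-∀)
  open import Data.Product using (∃₂; ∃-syntax; _×_; _,_)
  open import Data.Rational as ℚ using (ℚ; mkℚ)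
  import Data.Rational.Properties as ℚ
  open import Data.Rational.Unnormalised as ℚᵘ using (mkℚᵘ; *≡*)
  import Data.Rational.Unnormalised.Properties as ℚᵘ
  open import Data.Sum using (_⊎_; inj₁; inj₂)
  open import Relation.Binary.PropositionalEquality
  open import Relation.Nullary.Decidable using (recompute)

  record NumDen (a : ℚ) : Set where
    field
      N D     : ℕ
      1≤D     : 1 ≤ D
      2D<N    : 2 * D < N
      7N<24D  : 7 * N < 24 * D
      coprime : Coprime N D
      scale   : ∀ m → a ℚ.* (+ (D * m) ℚ./ 1) ≡ + (N * m) ℚ./ 1

    ratio : ∀ {m k n} → k ≡ D * m → n ≡ N * m → a ℚ.* (+ k ℚ./ 1) ≡ + n ℚ./ 1
    ratio refl refl = scale _

  scale-cross : ∀ N D m → (+ N ℤ.* + (D * m)) ℤ.* + 1 ≡ + (N * m) ℤ.* (+ D ℤ.* + 1)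
  scale-cross N D m = begin
    (+ N ℤ.* + (D * m)) ℤ.* + 1   ≡⟨ cong (ℤ._* + 1) (ℤ.pos-* N (D * m)) ⟨
    + (N * (D * m)) ℤ.* + 1       ≡⟨ ℤ.pos-* (N * (D * m)) 1 ⟨
    + (N * (D * m) * 1)           ≡⟨ cong +_ (regroup N D m) ⟩
    + (N * m * (D * 1))           ≡⟨ ℤ.pos-* (N * m) (D * 1) ⟩
    + (N * m) ℤ.* + (D * 1)       ≡⟨ cong (+ (N * m) ℤ.*_) (ℤ.pos-* D 1) ⟩
    + (N * m) ℤ.* (+ D ℤ.* + 1)   ∎
    where
    open ≡-Reasoning
    regroup : ∀ N D m → N * (D * m) * 1 ≡ N * m * (D * 1)
    regroup = solve-∀

  scale-mkℚ : ∀ N d m .(c : Coprime N (suc d)) → mkℚ (+ N) d c ℚ.* (+ (suc d * m) ℚ./ 1) ≡ + (N * m) ℚ./ 1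
  scale-mkℚ N d m c = ℚ.toℚᵘ-injective (begin
    ℚ.toℚᵘ (a ℚ.* (+ (suc d * m) ℚ./ 1))          ≈⟨ ℚ.toℚᵘ-homo-* a (+ (suc d * m) ℚ./ 1) ⟩
    mkℚᵘ (+ N) d ℚᵘ.* ℚ.toℚᵘ (+ (suc d * m) ℚ./ 1) ≈⟨ ℚᵘ.*-congˡ {mkℚᵘ (+ N) d} (ℚ.toℚᵘ-fromℚᵘ (mkℚᵘ (+ (suc d * m)) 0)) ⟩
    mkℚᵘ (+ N) d ℚᵘ.* mkℚᵘ (+ (suc d * m)) 0    ≈⟨ *≡* (scale-cross N (suc d) m) ⟩
    mkℚᵘ (+ (N * m)) 0                          ≈⟨ ℚᵘ.≃-sym (ℚ.toℚᵘ-fromℚᵘ (mkℚᵘ (+ (N * m)) 0)) ⟩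
    ℚ.toℚᵘ (+ (N * m) ℚ./ 1)                      ∎)
    where
    open ℚᵘ.≃-Reasoning
    a : ℚ
    a = mkℚ (+ N) d c

  numDen : (a : ℚ) → + 2 ℚ./ 1 ℚ.< a → a ℚ.< + 24 ℚ./ 7 → NumDen a
  numDen (mkℚ -[1+ n ] d _) (ℚ.*<* 2<a) _ = ⊥-elim (nonneg≮neg (subst (+ (2 * suc d) ℤ.<_) (ℤ.*-identityʳ -[1+ n ]) 2<a))
    where
    nonneg≮neg : ∀ {x} → + x ℤ.< -[1+ n ] → ⊥
    nonneg≮neg ()
  numDen (mkℚ (+ N) d c) (ℚ.*<* 2<a) (ℚ.*<* a<24/7) = record
    { N       = N
    ; D       = suc d
    ; 1≤D     = s≤s z≤n
    ; 2D<N    = ℤ.drop‿+<+ (subst₂ ℤ._<_ (sym (ℤ.pos-* 2 (suc d))) (ℤ.*-identityʳ (+ N)) 2<a)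
    ; 7N<24D  = ℤ.drop‿+<+ (subst₂ ℤ._<_ (trans (sym (ℤ.pos-* N 7)) (cong +_ (*-comm N 7)))
                                         (sym (ℤ.pos-* 24 (suc d))) a<24/7)
    ; coprime = recompute (coprime? N (suc d)) c
    ; scale   = λ m → scale-mkℚ N d m c
    }

  <-suc-quotient : ∀ m n .{{_ : NonZero n}} → m < suc (m / n) * n
  <-suc-quotient m n = begin-strict
    m                   ≡⟨ m≡m%n+[m/n]*n m n ⟩
    m % n + m / n * n   <⟨ +-monoˡ-< (m / n * n) (m%n<n m n) ⟩
    n + m / n * n       ≡⟨⟩
    suc (m / n) * n     ∎
    where open ≤-Reasoning

  -- N / D lies strictly between 4(p − 1)/(2p − 3) and 4p(p − 1)/(2p² − 5p + 4), where p = pp + 3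
  InWindow : (N D pp : ℕ) → Set
  InWindow N D pp = (4 * (2 + pp) * D + 1 ≤ (2 * pp + 3) * N)
                  × ((2 * pp * pp + 7 * pp + 7) * N + 1 ≤ 4 * (3 + pp) * (2 + pp) * D)

  window-lower : ∀ D g pp → 2 * D + g < suc (suc pp) * (2 * g) → 4 * (2 + pp) * D + 1 ≤ (2 * pp + 3) * (2 * D + g)
  window-lower D g pp hi = begin
    4 * (2 + pp) * D + 1                ≡⟨ eq₁ pp D ⟩
    (4 * pp + 6) * D + (2 * D + 1)      ≤⟨ +-monoʳ-≤ ((4 * pp + 6) * D) 2D+1≤[2pp+3]g ⟩
    (4 * pp + 6) * D + (2 * pp + 3) * g ≡⟨ eq₂ pp D g ⟩
    (2 * pp + 3) * (2 * D + g)          ∎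
    where
    open ≤-Reasoning
    eq₁ : ∀ pp D → 4 * (2 + pp) * D + 1 ≡ (4 * pp + 6) * D + (2 * D + 1)
    eq₁ = solve-∀
    eq₂ : ∀ pp D g → (4 * pp + 6) * D + (2 * pp + 3) * g ≡ (2 * pp + 3) * (2 * D + g)
    eq₂ = solve-∀
    eq₃ : ∀ D g → suc (2 * D + g) ≡ 2 * D + 1 + g
    eq₃ = solve-∀
    eq₄ : ∀ pp g → suc (suc pp) * (2 * g) ≡ (2 * pp + 3) * g + g
    eq₄ = solve-∀
    2D+1≤[2pp+3]g : 2 * D + 1 ≤ (2 * pp + 3) * g
    2D+1≤[2pp+3]g = +-cancelʳ-≤ g _ _ (subst₂ _≤_ (eq₃ D g) (eq₄ pp g) hi)

  window-upper : ∀ D g pp → 1 ≤ g → suc pp * (2 * g) ≤ 2 * D + g → 7 * (2 * D + g) < 24 * D →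
    (2 * pp * pp + 7 * pp + 7) * (2 * D + g) + 1 ≤ 4 * (3 + pp) * (2 + pp) * D
  window-upper D g zero    _   _  7N<24D = subst₂ _≤_ (+-comm 1 _) (eq D) 7N<24D
    where
    eq : ∀ D → 24 * D ≡ 4 * (3 + 0) * (2 + 0) * D
    eq = solve-∀
  window-upper D g (suc k) 1≤g lo _ = begin
    cc * (2 * D + g) + 1
      ≤⟨ +-monoʳ-≤ (cc * (2 * D + g)) (≤-trans 1≤g (m≤n*m g (8 + 14 * k + 4 * k * k))) ⟩
    cc * (2 * D + g) + (8 + 14 * k + 4 * k * k) * g
      ≡⟨ eq₁ k D g ⟩
    cc * (2 * D) + (3 * suc k + 5) * ((2 * suc k + 1) * g)
      ≤⟨ +-monoʳ-≤ (cc * (2 * D)) (*-monoʳ-≤ (3 * suc k + 5) [2k+3]g≤2D) ⟩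
    cc * (2 * D) + (3 * suc k + 5) * (2 * D)
      ≡⟨ eq₂ (suc k) D ⟩
    4 * (3 + suc k) * (2 + suc k) * D ∎
    where
    open ≤-Reasoning
    cc : ℕ
    cc = 2 * suc k * suc k + 7 * suc k + 7
    eq₁ : ∀ k D g → (2 * suc k * suc k + 7 * suc k + 7) * (2 * D + g) + (8 + 14 * k + 4 * k * k) * g
                 ≡ (2 * suc k * suc k + 7 * suc k + 7) * (2 * D) + (3 * suc k + 5) * ((2 * suc k + 1) * g)
    eq₁ = solve-∀
    eq₂ : ∀ pp D → (2 * pp * pp + 7 * pp + 7) * (2 * D) + (3 * pp + 5) * (2 * D) ≡ 4 * (3 + pp) * (2 + pp) * D
    eq₂ = solve-∀
    eq₃ : ∀ k g → suc (suc k) * (2 * g) ≡ (2 * suc k + 1) * g + g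
    eq₃ = solve-∀
    [2k+3]g≤2D : (2 * suc k + 1) * g ≤ 2 * D
    [2k+3]g≤2D = +-cancelʳ-≤ g _ _ (subst (_≤ 2 * D + g) (eq₃ k g) lo)

  window-from-quotient : ∀ D g κ → 1 ≤ g → κ * (2 * g) ≤ 2 * D + g → 2 * D + g < suc κ * (2 * g) →
    7 * (2 * D + g) < 24 * D → ∃[ pp ] InWindow (2 * D + g) D pp
  window-from-quotient D g zero     _   _  hi 7N<24D = ⊥-elim (<-asym 7N<24D (begin-strict
    24 * D                    <⟨ m<m+n (24 * D) (≤-trans (s≤s z≤n) (m≤n+m 7 (4 * D))) ⟩
    24 * D + (4 * D + 7)      ≡⟨ eq₁ D ⟩
    7 * (2 * D + (2 * D + 1)) ≤⟨ *-monoʳ-≤ 7 (+-monoʳ-≤ (2 * D) (+-cancelʳ-≤ g _ _ (subst₂ _≤_ (eq₂ D g) (eq₃ g) hi))) ⟩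
    7 * (2 * D + g)           ∎))
    where
    open ≤-Reasoning
    eq₁ : ∀ D → 24 * D + (4 * D + 7) ≡ 7 * (2 * D + (2 * D + 1))
    eq₁ = solve-∀
    eq₂ : ∀ D g → suc (2 * D + g) ≡ 2 * D + 1 + g
    eq₂ = solve-∀
    eq₃ : ∀ g → 1 * (2 * g) ≡ g + g
    eq₃ = solve-∀
  window-from-quotient D g (suc pp) 1≤g lo hi 7N<24D =
    pp , window-lower D g pp hi , window-upper D g pp 1≤g lo 7N<24D

  -- the window is found at p = ⌊N / 2(N − 2D)⌋ + 2
  choose-window : ∀ {N D} → 2 * D < N → 7 * N < 24 * D → ∃[ pp ] InWindow N D pp
  choose-window {N} {D} 2D<N 7N<24D = subst (λ M → ∃[ pp ] InWindow M D pp) N≡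
    (window-from-quotient D g ((2 * D + g) / (2 * g)) 1≤g (m/n*n≤m (2 * D + g) (2 * g))
       (<-suc-quotient (2 * D + g) (2 * g)) (subst (λ M → 7 * M < 24 * D) (sym N≡) 7N<24D))
    where
    g : ℕ
    g = N ∸ 2 * D
    N≡ : 2 * D + g ≡ N
    N≡ = m+[n∸m]≡n (<⇒≤ 2D<N)
    1≤g : 1 ≤ g
    1≤g = m<n⇒0<n∸m 2D<N
    instance
      2g≢0 : NonZero (2 * g)
      2g≢0 = >-nonZero (≤-trans 1≤g (m≤m+n g (g + 0)))

  even-or-odd : ∀ x → ∃[ h ] (x ≡ 2 * h ⊎ x ≡ 1 + 2 * h)
  even-or-odd zero    = 0 , inj₁ refl
  even-or-odd (suc x) with even-or-odd x
  ... | h , inj₁ x≡2h   = h , inj₂ (cong suc x≡2h)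
  ... | h , inj₂ x≡1+2h = suc h , inj₁ (trans (cong suc x≡1+2h) (eq h))
    where
    eq : ∀ h → 2 + 2 * h ≡ 2 * suc h
    eq = solve-∀

  bézout-step : ∀ {N D} → 1 ≤ D → Coprime N D → ∃₂ λ m z → N * m + 1 ≡ D * z
  bézout-step {N} {D} _ coprime with coprime-Bézout coprime
  ... | Bézout.-+ x y 1+xN≡yD = x , y , trans (trans (+-comm (N * x) 1) (cong suc (*-comm N x))) (trans 1+xN≡yD (*-comm y D))
  bézout-step {N} {suc d} _ coprime | Bézout.+- x y 1+yD≡xN = x * d , suc (y * d) , (begin
    N * (x * d) + 1            ≡⟨ eq₁ N x d ⟩
    x * N * d + 1              ≡⟨ cong (λ t → t * d + 1) 1+yD≡xN ⟨
    (1 + y * suc d) * d + 1    ≡⟨ eq₂ y d ⟩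
    suc d * suc (y * d)        ∎)
    where
    open ≡-Reasoning
    eq₁ : ∀ N x d → N * (x * d) + 1 ≡ x * N * d + 1
    eq₁ = solve-∀
    eq₂ : ∀ y d → (1 + y * suc d) * d + 1 ≡ suc d * suc (y * d)
    eq₂ = solve-∀

  base-solution : ∀ {N D} → 1 ≤ D → Coprime N D → ∃₂ λ m₀ s₀ → 2 * D * s₀ ≡ N * (N * m₀ + 1)
  base-solution {N} {D} 1≤D coprime with bézout-step 1≤D coprime
  ... | m , z , Nm+1≡Dz with even-or-odd N | even-or-odd z
  ... | h , inj₁ N≡2h | _ = m , h * z , (begin
    2 * D * (h * z)         ≡⟨ eq D h z ⟩
    (2 * h) * (D * z)       ≡⟨ cong₂ _*_ N≡2h Nm+1≡Dz ⟨
    N * (N * m + 1)         ∎)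
    where
    open ≡-Reasoning
    eq : ∀ D h z → 2 * D * (h * z) ≡ (2 * h) * (D * z)
    eq = solve-∀
  ... | _ , inj₂ _ | h , inj₁ z≡2h = m , N * h , (begin
    2 * D * (N * h)         ≡⟨ eq D N h ⟩
    N * (D * (2 * h))       ≡⟨ cong (λ t → N * (D * t)) z≡2h ⟨
    N * (D * z)             ≡⟨ cong (N *_) Nm+1≡Dz ⟨
    N * (N * m + 1)         ∎)
    where
    open ≡-Reasoning
    eq : ∀ D N h → 2 * D * (N * h) ≡ N * (D * (2 * h))
    eq = solve-∀
  ... | h , inj₂ N≡1+2h | h′ , inj₂ z≡1+2h′ = m + D , N * (1 + h + h′) , (begin
    2 * D * (N * (1 + h + h′))        ≡⟨ eq₁ D N h h′ ⟩
    N * (D * ((1 + 2 * h′) + (1 + 2 * h))) ≡⟨ cong₂ (λ a b → N * (D * (a + b))) z≡1+2h′ N≡1+2h ⟨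
    N * (D * (z + N))                 ≡⟨ cong (N *_) (eq₂ D z N) ⟩
    N * (D * z + N * D)               ≡⟨ cong (λ t → N * (t + N * D)) Nm+1≡Dz ⟨
    N * (N * m + 1 + N * D)           ≡⟨ cong (N *_) (eq₃ N m D) ⟩
    N * (N * (m + D) + 1)             ∎)
    where
    open ≡-Reasoning
    eq₁ : ∀ D N h h′ → 2 * D * (N * (1 + h + h′)) ≡ N * (D * ((1 + 2 * h′) + (1 + 2 * h)))
    eq₁ = solve-∀
    eq₂ : ∀ D z N → D * (z + N) ≡ D * z + N * D
    eq₂ = solve-∀
    eq₃ : ∀ N m D → N * m + 1 + N * D ≡ N * (m + D) + 1
    eq₃ = solve-∀

module HardInstances where

  open import Defs
  open FiniteSums
  open Exchange
  open RunInstances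
  open Arithmetic
  open import Data.List using ([]; _∷_)
  open import Data.Nat using (ℕ; zero; suc; _+_; _*_; _∸_; _≤_; _<_; z≤n; s≤s; NonZero; >-nonZero)
  open import Data.Nat.DivMod using (_/_; _%_; m≡m%n+[m/n]*n; m%n<n; m/n*n≤m; /-monoʳ-≤)
  open import Data.Nat.Coprimality using (Coprime)
  open import Data.Nat.Properties
  open import Data.Nat.Tactic.RingSolver using (solve-∀)
  open import Data.Product using (∃-syntax; _×_; _,_; proj₁; proj₂)
  open import Data.List.Relation.Unary.All using (All; []; _∷_)
  open import Data.List.Relation.Unary.Linked using (Linked; []; [-]; _∷_)
  open import Data.Unit using (tt)
  open import Relation.Binary.PropositionalEquality hiding (J)
  open import Relation.Nullary using (¬_)

  open ≤-Reasoning

  summands≤ : ∀ {a b c d e f n} → a + b + c + d + e + f ≤ n →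
    a ≤ n × b ≤ n × c ≤ n × d ≤ n × e ≤ n × f ≤ n
  summands≤ {a} {b} {c} {d} {e} {f} {n} le =
      ≤-trans (≤-trans (≤-trans (≤-trans (m≤m+n a b) (m≤m+n _ c)) (m≤m+n _ d)) (m≤m+n _ e)) le′
    , ≤-trans (≤-trans (≤-trans (≤-trans (m≤n+m b a) (m≤m+n _ c)) (m≤m+n _ d)) (m≤m+n _ e)) le′
    , ≤-trans (≤-trans (≤-trans (m≤n+m c (a + b)) (m≤m+n _ d)) (m≤m+n _ e)) le′
    , ≤-trans (≤-trans (m≤n+m d (a + b + c)) (m≤m+n _ e)) le′
    , ≤-trans (m≤n+m e (a + b + c + d)) le′
    , ≤-trans (m≤n+m f (a + b + c + d + e)) le
    where
    le′ : a + b + c + d + e ≤ n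
    le′ = ≤-trans (m≤m+n (a + b + c + d + e) f) le

  gap-identity : ∀ pp L w ρ →
    let p = 3 + pp ; p₁ = 2 + pp ; p₂ = 1 + pp ; c = 2 * pp * pp + 7 * pp + 7
        n = L + w ; u = suc w ; s = ρ + w * (2 * p₁) in
    4 * p₁ * p₁ * (p₂ * s * (2 * n) + 2 * L * s) + (2 * pp + 3) * s * (c * s) + 2 * p₁ * n * (2 * p * p₁ * n)
      + 4 * p * p₁ * p₁ * L
    ≡ 4 * p₁ * p₁ * (p₂ * s * s + p * L * (n + u)) + (2 * pp + 3) * s * (2 * p * p₁ * n) + 2 * p₁ * n * (c * s)
      + (12 * pp * ρ * w + 3 * pp * ρ * ρ + 4 * pp * pp * ρ * w + 8 * ρ * w + 5 * ρ * ρ)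
  gap-identity = solve-∀

  cancel-cross : ∀ X₁ X₂ Y z y₁ y₂ b₁ b₂ →
    X₁ + (y₁ + b₁) * b₂ + b₁ * (y₂ + b₂) + Y ≡ X₂ + (y₁ + b₁) * (y₂ + b₂) + b₁ * b₂ + z →
    X₁ + Y ≡ X₂ + y₁ * y₂ + z
  cancel-cross X₁ X₂ Y z y₁ y₂ b₁ b₂ eq = +-cancelʳ-≡ (y₁ * b₂ + b₁ * y₂ + 2 * (b₁ * b₂)) _ _
    (trans (eq₁ X₁ Y y₁ y₂ b₁ b₂) (trans eq (eq₂ X₂ z y₁ y₂ b₁ b₂)))
    where
    eq₁ : ∀ X₁ Y y₁ y₂ b₁ b₂ → X₁ + Y + (y₁ * b₂ + b₁ * y₂ + 2 * (b₁ * b₂)) ≡ X₁ + (y₁ + b₁) * b₂ + b₁ * (y₂ + b₂) + Y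
    eq₁ = solve-∀
    eq₂ : ∀ X₂ z y₁ y₂ b₁ b₂ → X₂ + (y₁ + b₁) * (y₂ + b₂) + b₁ * b₂ + z ≡ X₂ + y₁ * y₂ + z + (y₁ * b₂ + b₁ * y₂ + 2 * (b₁ * b₂))
    eq₂ = solve-∀

  module Construction (N D pp : ℕ) (1≤D : 1 ≤ D) (2D<N : 2 * D < N) (7N<24D : 7 * N < 24 * D)
                      (window : InWindow N D pp) where

    p p₁ p₂ : ℕ
    p  = 3 + pp
    p₁ = 2 + pp
    p₂ = 1 + pp

    c Z M W wₘᵢₙ : ℕ
    c    = 2 * pp * pp + 7 * pp + 7
    Z    = 4 * D * D * (4 * p₁ * p₁)
    M    = 4 * D * D * (4 * p * p₁ * p₁) + c * N
    W    = 16 * p₂ * Z + 1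
    wₘᵢₙ = W + ((4 + pp) * (5 + pp) + (4 + pp)) + (4 + pp) * ((4 + pp) * pp + 1)

    nΔ nJ nw nc nW threshold : ℕ
    nΔ = 16 * D * p₁ * (p₂ * p₂)
    nJ = (3 * pp + 5) * N + 8 * (4 * D * p₁) * p
    nw = 2 * p₁ * (wₘᵢₙ + 1)
    nc = c * N
    nW = Z * (4 * W * pp + 8 * p₂ * (W * W)) + W * M
    threshold = 6 + nΔ + nJ + nw + nc + nW

    module Instance (n s k : ℕ) (2Ds≡ : 2 * D * s ≡ N * suc n) (2ks≡ : 2 * k * s ≡ n * suc n)
                    (large : threshold ≤ n) where

      private
        bounds : 6 ≤ n × nΔ ≤ n × nJ ≤ n × nw ≤ n × nc ≤ n × nW ≤ n
        bounds = summands≤ {6} {nΔ} {nJ} {nw} {nc} {nW} large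

      6≤n : 6 ≤ n
      6≤n = proj₁ bounds
      nΔ≤n : nΔ ≤ n
      nΔ≤n = proj₁ (proj₂ bounds)
      nJ≤n : nJ ≤ n
      nJ≤n = proj₁ (proj₂ (proj₂ bounds))
      nw≤n : nw ≤ n
      nw≤n = proj₁ (proj₂ (proj₂ (proj₂ bounds)))
      nc≤n : nc ≤ n
      nc≤n = proj₁ (proj₂ (proj₂ (proj₂ (proj₂ bounds))))
      nW≤n : nW ≤ n
      nW≤n = proj₂ (proj₂ (proj₂ (proj₂ (proj₂ bounds))))

      n<s : n < s
      n<s = *-cancelˡ-≤ (2 * D) ⦃ >-nonZero (≤-trans 1≤D (m≤m+n D (D + 0))) ⦄ (begin
        2 * D * suc n   ≤⟨ *-monoˡ-≤ (suc n) (<⇒≤ 2D<N) ⟩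
        N * suc n       ≡⟨ 2Ds≡ ⟨
        2 * D * s       ∎)

      s≤2n : s ≤ 2 * n
      s≤2n = *-cancelˡ-≤ (14 * D) ⦃ >-nonZero (≤-trans 1≤D (m≤m+n D (13 * D))) ⦄ (begin
        14 * D * s           ≡⟨ eq₁ D s ⟩
        7 * (2 * D * s)      ≡⟨ cong (7 *_) 2Ds≡ ⟩
        7 * (N * suc n)      ≡⟨ *-assoc 7 N (suc n) ⟨
        7 * N * suc n        ≤⟨ *-monoˡ-≤ (suc n) (<⇒≤ 7N<24D) ⟩
        24 * D * suc n       ≡⟨ eq₂ D n ⟩
        D * (24 * n + 24)    ≤⟨ *-monoʳ-≤ D (+-monoʳ-≤ (24 * n) (*-monoʳ-≤ 4 6≤n)) ⟩
        D * (24 * n + 4 * n) ≡⟨ eq₃ D n ⟩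
        14 * D * (2 * n)     ∎)
        where
        eq₁ : ∀ D s → 14 * D * s ≡ 7 * (2 * D * s)
        eq₁ = solve-∀
        eq₂ : ∀ D n → 24 * D * suc n ≡ D * (24 * n + 24)
        eq₂ = solve-∀
        eq₃ : ∀ D n → D * (24 * n + 4 * n) ≡ 14 * D * (2 * n)
        eq₃ = solve-∀

      instance
        2p₁≢0 : NonZero (2 * p₁)
        2p₁≢0 = _
        s≢0 : NonZero s
        s≢0 = >-nonZero (≤-trans (s≤s z≤n) n<s)
        2s≢0 : NonZero (2 * s)
        2s≢0 = >-nonZero (≤-trans (s≤s z≤n) (≤-trans n<s (m≤m+n s (s + 0))))

      opaque
        w ρ : ℕ
        w = s / (2 * p₁)
        ρ = s % (2 * p₁)

        s≡ρ+2p₁w : s ≡ ρ + w * (2 * p₁)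
        s≡ρ+2p₁w = m≡m%n+[m/n]*n s (2 * p₁)

        2p₁w≤s : 2 * p₁ * w ≤ s
        2p₁w≤s = subst (_≤ s) (*-comm w (2 * p₁)) (m/n*n≤m s (2 * p₁))

        s<2p₁[w+1] : s < 2 * p₁ * suc w
        s<2p₁[w+1] = subst (s <_) (*-comm (suc w) (2 * p₁)) (<-suc-quotient s (2 * p₁))

        w≤s/2 : w ≤ s / 2
        w≤s/2 = /-monoʳ-≤ s (*-monoʳ-≤ 2 (m≤m+n 1 (1 + pp)))

      u : ℕ
      u = suc w

      s<2p₁u : s < 2 * p₁ * u
      s<2p₁u = s<2p₁[w+1]

      2p₁u≤s+2p₁ : 2 * p₁ * u ≤ s + 2 * p₁
      2p₁u≤s+2p₁ = begin
        2 * p₁ * suc w      ≡⟨ eq p₁ w ⟩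
        2 * p₁ * w + 2 * p₁ ≤⟨ +-monoˡ-≤ (2 * p₁) 2p₁w≤s ⟩
        s + 2 * p₁          ∎
        where
        eq : ∀ a w → 2 * a * suc w ≡ 2 * a * w + 2 * a
        eq = solve-∀

      4w≤2n : 4 * w ≤ 2 * n
      4w≤2n = ≤-trans (*-monoˡ-≤ w (*-monoʳ-≤ 2 (m≤m+n 2 pp))) (≤-trans 2p₁w≤s s≤2n)

      u≤n : u ≤ n
      u≤n = *-cancelˡ-≤ 2 (begin
        2 * suc w     ≡⟨ eq₁ w ⟩
        2 * w + 2     ≤⟨ +-monoˡ-≤ 2 (*-cancelˡ-≤ 2 (≤-trans (≤-reflexive (eq₂ w)) 4w≤2n)) ⟩
        n + 2         ≤⟨ +-monoʳ-≤ n (≤-trans (s≤s (s≤s z≤n)) 6≤n) ⟩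
        n + n         ≡⟨ eq₃ n ⟩
        2 * n         ∎)
        where
        eq₁ : ∀ w → 2 * suc w ≡ 2 * w + 2
        eq₁ = solve-∀
        eq₂ : ∀ w → 2 * (2 * w) ≡ 4 * w
        eq₂ = solve-∀
        eq₃ : ∀ n → n + n ≡ 2 * n
        eq₃ = solve-∀

      opaque
        L : ℕ
        L = suc n ∸ u

        L+u≡ : L + u ≡ suc n
        L+u≡ = m∸n+n≡m (≤-trans u≤n (n≤1+n n))

        1≤L : 1 ≤ L
        1≤L = m<n⇒0<n∸m (s≤s u≤n)

      n≡L+w : n ≡ L + w
      n≡L+w = suc-injective (trans (sym L+u≡) (+-suc L w))

      L≤n : L ≤ n
      L≤n = subst (L ≤_) (sym n≡L+w) (m≤m+n L w)

      n≤2L : n ≤ 2 * L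
      n≤2L = +-cancelʳ-≤ (2 * w) _ _ (begin
        n + 2 * w          ≤⟨ +-monoʳ-≤ n (*-cancelˡ-≤ 2 (≤-trans (≤-reflexive (eq₁ w)) 4w≤2n)) ⟩
        n + n              ≡⟨ cong (λ m → m + m) n≡L+w ⟩
        (L + w) + (L + w)  ≡⟨ eq₂ L w ⟩
        2 * L + 2 * w      ∎)
        where
        eq₁ : ∀ w → 2 * (2 * w) ≡ 4 * w
        eq₁ = solve-∀
        eq₂ : ∀ L w → (L + w) + (L + w) ≡ 2 * L + 2 * w
        eq₂ = solve-∀

      T : ℕ
      T = topSum n L

      opaque
        J e : ℕ
        J = T / s
        e = T % s

        Js+e≡T : J * s + e ≡ T
        Js+e≡T = trans (+-comm (J * s) e) (sym (m≡m%n+[m/n]*n T s))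

        e<s : e < s
        e<s = m%n<n T s

      2T≡L[n+u] : 2 * T ≡ L * (n + u)
      2T≡L[n+u] = +-cancelʳ-≡ (L * L) _ _ (begin-equality
        2 * T + L * L               ≡⟨ topSum-closed L≤n ⟩
        2 * L * n + L               ≡⟨ cong (λ m → 2 * L * m + L) n≡L+w ⟩
        2 * L * (L + w) + L         ≡⟨ eq L w ⟩
        L * ((L + w) + u) + L * L   ≡⟨ cong (λ m → L * (m + u) + L * L) n≡L+w ⟨
        L * (n + u) + L * L         ∎)
        where
        eq : ∀ L w → 2 * L * (L + w) + L ≡ L * ((L + w) + suc w) + L * L
        eq = solve-∀

      n[n+1]≡ : n * suc n ≡ L * (n + u) + w * u
      n[n+1]≡ = begin-equality
        n * suc n                       ≡⟨ cong (λ m → m * suc m) n≡L+w ⟩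
        (L + w) * suc (L + w)           ≡⟨ eq L w ⟩
        L * ((L + w) + u) + w * u       ≡⟨ cong (λ m → L * (m + u) + w * u) n≡L+w ⟨
        L * (n + u) + w * u             ∎
        where
        eq : ∀ L w → (L + w) * suc (L + w) ≡ L * ((L + w) + suc w) + w * suc w
        eq = solve-∀

      2Js≤L[n+u] : 2 * J * s ≤ L * (n + u)
      2Js≤L[n+u] = begin
        2 * J * s          ≡⟨ *-assoc 2 J s ⟩
        2 * (J * s)        ≤⟨ *-monoʳ-≤ 2 (m≤m+n (J * s) e) ⟩
        2 * (J * s + e)     ≡⟨ cong (2 *_) Js+e≡T ⟩
        2 * T              ≡⟨ 2T≡L[n+u] ⟩
        L * (n + u)        ∎

      -- the lower end of the window: it forces 2J < L
      4Dp₁[n+u]+n<4Dp₁s : 4 * D * p₁ * (n + u) + suc n ≤ 4 * D * p₁ * s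
      4Dp₁[n+u]+n<4Dp₁s = begin
        4 * D * p₁ * (n + u) + suc n                  ≡⟨ eq₁ D p₁ n u ⟩
        2 * D * (2 * p₁ * n) + 2 * D * (2 * p₁ * u) + suc n
          ≤⟨ +-monoˡ-≤ (suc n) (+-monoʳ-≤ (2 * D * (2 * p₁ * n)) (*-monoʳ-≤ (2 * D) 2p₁u≤s+2p₁)) ⟩
        2 * D * (2 * p₁ * n) + 2 * D * (s + 2 * p₁) + suc n ≡⟨ eq₂ D p₁ n s ⟩
        (4 * p₁ * D + 1) * suc n + 2 * D * s           ≤⟨ +-monoˡ-≤ (2 * D * s) (*-monoˡ-≤ (suc n) (proj₁ window)) ⟩
        (2 * pp + 3) * N * suc n + 2 * D * s           ≡⟨ cong (_+ 2 * D * s) (trans (*-assoc (2 * pp + 3) N (suc n)) (cong ((2 * pp + 3) *_) (sym 2Ds≡))) ⟩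
        (2 * pp + 3) * (2 * D * s) + 2 * D * s         ≡⟨ eq₃ pp D s ⟩
        4 * D * p₁ * s                                 ∎
        where
        eq₁ : ∀ D p₁ n u → 4 * D * p₁ * (n + u) + suc n ≡ 2 * D * (2 * p₁ * n) + 2 * D * (2 * p₁ * u) + suc n
        eq₁ = solve-∀
        eq₂ : ∀ D p₁ n s → 2 * D * (2 * p₁ * n) + 2 * D * (s + 2 * p₁) + suc n ≡ (4 * p₁ * D + 1) * suc n + 2 * D * s
        eq₂ = solve-∀
        eq₃ : ∀ pp D s → (2 * pp + 3) * (2 * D * s) + 2 * D * s ≡ 4 * D * (2 + pp) * s
        eq₃ = solve-∀

      2J[4Dp₁s]+L[n+1]≤L[4Dp₁s] : 2 * J * (4 * D * p₁ * s) + L * suc n ≤ L * (4 * D * p₁ * s)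
      2J[4Dp₁s]+L[n+1]≤L[4Dp₁s] = begin
        2 * J * (4 * D * p₁ * s) + L * suc n           ≡⟨ eq₁ J (4 * D * p₁) s (L * suc n) ⟩
        4 * D * p₁ * (2 * J * s) + L * suc n           ≤⟨ +-monoˡ-≤ (L * suc n) (*-monoʳ-≤ (4 * D * p₁) 2Js≤L[n+u]) ⟩
        4 * D * p₁ * (L * (n + u)) + L * suc n         ≡⟨ eq₂ (4 * D * p₁) L (n + u) (suc n) ⟩
        L * (4 * D * p₁ * (n + u) + suc n)             ≤⟨ *-monoʳ-≤ L 4Dp₁[n+u]+n<4Dp₁s ⟩
        L * (4 * D * p₁ * s)                           ∎
        where
        eq₁ : ∀ J c s x → 2 * J * (c * s) + x ≡ c * (2 * J * s) + x
        eq₁ = solve-∀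
        eq₂ : ∀ c L a b → c * (L * a) + L * b ≡ L * (c * a + b)
        eq₂ = solve-∀

      2J<L : 2 * J < L
      2J<L = *-cancelʳ-< (4 * D * p₁ * s) (2 * J) L (begin-strict
        2 * J * (4 * D * p₁ * s)               <⟨ m<m+n _ (*-mono-≤ 1≤L (s≤s z≤n)) ⟩
        2 * J * (4 * D * p₁ * s) + L * suc n   ≤⟨ 2J[4Dp₁s]+L[n+1]≤L[4Dp₁s] ⟩
        L * (4 * D * p₁ * s)                   ∎)

      -- Splitting the first J blocks into runs of 2, p and p + 1

      opaque
        Δ : ℕ
        Δ = L ∸ 2 * J

        L≡2J+Δ : L ≡ 2 * J + Δ
        L≡2J+Δ = sym (m+[n∸m]≡n (<⇒≤ 2J<L))

      L[n+1]≤4Dp₁Δs : L * suc n ≤ 4 * D * p₁ * Δ * s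
      L[n+1]≤4Dp₁Δs = +-cancelˡ-≤ (2 * J * (4 * D * p₁ * s)) _ _ (begin
        2 * J * (4 * D * p₁ * s) + L * suc n          ≤⟨ 2J[4Dp₁s]+L[n+1]≤L[4Dp₁s] ⟩
        L * (4 * D * p₁ * s)                          ≡⟨ cong (_* (4 * D * p₁ * s)) L≡2J+Δ ⟩
        (2 * J + Δ) * (4 * D * p₁ * s)                ≡⟨ eq J Δ (4 * D * p₁) s ⟩
        2 * J * (4 * D * p₁ * s) + 4 * D * p₁ * Δ * s ∎)
        where
        eq : ∀ J Δ c s → (2 * J + Δ) * (c * s) ≡ 2 * J * (c * s) + c * Δ * s
        eq = solve-∀

      p₂²<Δ : p₂ * p₂ < Δ
      p₂²<Δ = *-cancelˡ-< (16 * D * p₁) (p₂ * p₂) Δ (begin-strict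
        16 * D * p₁ * (p₂ * p₂) ≤⟨ nΔ≤n ⟩
        n                       <⟨ n<1+n n ⟩
        suc n                   ≤⟨ *-cancelˡ-≤ n ⦃ >-nonZero (≤-trans (s≤s z≤n) 6≤n) ⦄ n[n+1]≤n[16Dp₁Δ] ⟩
        16 * D * p₁ * Δ         ∎)
        where
        n[n+1]≤n[16Dp₁Δ] : n * suc n ≤ n * (16 * D * p₁ * Δ)
        n[n+1]≤n[16Dp₁Δ] = begin
          n * suc n                      ≤⟨ *-monoˡ-≤ (suc n) n≤2L ⟩
          2 * L * suc n                  ≡⟨ *-assoc 2 L (suc n) ⟩
          2 * (L * suc n)                ≤⟨ *-monoʳ-≤ 2 L[n+1]≤4Dp₁Δs ⟩
          2 * (4 * D * p₁ * Δ * s)       ≤⟨ *-monoʳ-≤ 2 (*-monoʳ-≤ (4 * D * p₁ * Δ) s≤2n) ⟩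
          2 * (4 * D * p₁ * Δ * (2 * n)) ≡⟨ eq D p₁ Δ n ⟩
          n * (16 * D * p₁ * Δ)          ∎
          where
          eq : ∀ D p₁ Δ n → 2 * (4 * D * p₁ * Δ * (2 * n)) ≡ n * (16 * D * p₁ * Δ)
          eq = solve-∀

      opaque
        t t₂ : ℕ
        t  = Δ / p₂
        t₂ = Δ % p₂

        Δ≡t₂+tp₂ : Δ ≡ t₂ + t * p₂
        Δ≡t₂+tp₂ = m≡m%n+[m/n]*n Δ p₂

        t₂<p₂ : t₂ < p₂
        t₂<p₂ = m%n<n Δ p₂

      p₂≤t : p₂ ≤ t
      p₂≤t = ≮⇒≥ λ t<p₂ → <-asym p₂²<Δ (begin-strict
        Δ                    ≡⟨ Δ≡t₂+tp₂ ⟩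
        t₂ + t * p₂          <⟨ +-mono-<-≤ t₂<p₂ (*-monoˡ-≤ p₂ (≤-pred t<p₂)) ⟩
        p₂ + pp * p₂         ≡⟨⟩
        p₂ * p₂              ∎)

      opaque
        t₁ : ℕ
        t₁ = t ∸ t₂

        t≡t₁+t₂ : t ≡ t₁ + t₂
        t≡t₁+t₂ = sym (m∸n+n≡m (≤-trans (<⇒≤ t₂<p₂) p₂≤t))

      L[n+u]≡2Js+2e : L * (n + u) ≡ 2 * J * s + 2 * e
      L[n+u]≡2Js+2e = begin-equality
        L * (n + u)        ≡⟨ 2T≡L[n+u] ⟨
        2 * T              ≡⟨ cong (2 *_) Js+e≡T ⟨
        2 * (J * s + e)    ≡⟨ eq J s e ⟩
        2 * J * s + 2 * e  ∎
        where
        eq : ∀ J s e → 2 * (J * s + e) ≡ 2 * J * s + 2 * e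
        eq = solve-∀

      -- the upper end of the window: it forces L ≤ pJ
      8Dp₁s+n≤4Dp₁p[n+u]+cN : 2 * (4 * D * p₁) * s + n ≤ 4 * D * p₁ * p * (n + u) + (3 * pp + 5) * N
      8Dp₁s+n≤4Dp₁p[n+u]+cN = begin
        2 * (4 * D * p₁) * s + n                           ≡⟨ eq₁ D pp s n ⟩
        2 * D * p * s + (3 * pp + 5) * (2 * D * s) + n     ≡⟨ cong (λ x → 2 * D * p * s + (3 * pp + 5) * x + n) 2Ds≡ ⟩
        2 * D * p * s + (3 * pp + 5) * (N * suc n) + n     ≡⟨ eq₂ (2 * D * p * s) (3 * pp + 5) N n ⟩
        2 * D * p * s + ((3 * pp + 5) * N + 1) * n + (3 * pp + 5) * N
          ≤⟨ +-monoˡ-≤ ((3 * pp + 5) * N) (+-monoʳ-≤ (2 * D * p * s) (*-monoˡ-≤ n [3pp+5]N<4pp₁D)) ⟩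
        2 * D * p * s + 4 * p * p₁ * D * n + (3 * pp + 5) * N
          ≤⟨ +-monoˡ-≤ ((3 * pp + 5) * N) (+-monoˡ-≤ (4 * p * p₁ * D * n) (*-monoʳ-≤ (2 * D * p) (<⇒≤ s<2p₁u))) ⟩
        2 * D * p * (2 * p₁ * u) + 4 * p * p₁ * D * n + (3 * pp + 5) * N ≡⟨ cong (_+ (3 * pp + 5) * N) (eq₃ D p p₁ u n) ⟩
        4 * D * p₁ * p * (n + u) + (3 * pp + 5) * N        ∎
        where
        [3pp+5]N<4pp₁D : (3 * pp + 5) * N + 1 ≤ 4 * p * p₁ * D
        [3pp+5]N<4pp₁D = ≤-trans (+-monoˡ-≤ 1 (*-monoˡ-≤ N (≤-trans (m≤m+n (3 * pp + 5) (2 * pp * pp + 4 * pp + 2)) (≤-reflexive (eq pp)))))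
                                 (proj₂ window)
          where
          eq : ∀ pp → 3 * pp + 5 + (2 * pp * pp + 4 * pp + 2) ≡ 2 * pp * pp + 7 * pp + 7
          eq = solve-∀
        eq₁ : ∀ D pp s n → 2 * (4 * D * (2 + pp)) * s + n ≡ 2 * D * (3 + pp) * s + (3 * pp + 5) * (2 * D * s) + n
        eq₁ = solve-∀
        eq₂ : ∀ a b N n → a + b * (N * suc n) + n ≡ a + (b * N + 1) * n + b * N
        eq₂ = solve-∀
        eq₃ : ∀ D p p₁ u n → 2 * D * p * (2 * p₁ * u) + 4 * p * p₁ * D * n ≡ 4 * D * p₁ * p * (n + u)
        eq₃ = solve-∀

      L≤pJ : L ≤ p * J
      L≤pJ = *-cancelˡ-≤ (2 * (4 * D * p₁) * s) ⦃ >-nonZero 1≤8Dp₁s ⦄ (+-cancelʳ-≤ (L * n) _ _ (begin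
        2 * (4 * D * p₁) * s * L + L * n                  ≡⟨ eq₁ (4 * D * p₁) s L n ⟩
        L * (2 * (4 * D * p₁) * s + n)                    ≤⟨ *-monoʳ-≤ L 8Dp₁s+n≤4Dp₁p[n+u]+cN ⟩
        L * (4 * D * p₁ * p * (n + u) + (3 * pp + 5) * N) ≡⟨ eq₂ L (4 * D * p₁ * p) (n + u) ((3 * pp + 5) * N) ⟩
        4 * D * p₁ * p * (L * (n + u)) + L * ((3 * pp + 5) * N)  ≡⟨ cong (λ x → 4 * D * p₁ * p * x + L * ((3 * pp + 5) * N)) L[n+u]≡2Js+2e ⟩
        4 * D * p₁ * p * (2 * J * s + 2 * e) + L * ((3 * pp + 5) * N)
          ≤⟨ +-monoˡ-≤ (L * ((3 * pp + 5) * N)) (*-monoʳ-≤ (4 * D * p₁ * p) (+-monoʳ-≤ (2 * J * s) (*-monoʳ-≤ 2 (<⇒≤ e<s)))) ⟩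
        4 * D * p₁ * p * (2 * J * s + 2 * s) + L * ((3 * pp + 5) * N) ≡⟨ eq₃ (4 * D * p₁) p J s (L * ((3 * pp + 5) * N)) ⟩
        (L * ((3 * pp + 5) * N) + 2 * (4 * D * p₁) * p * s) + 2 * (4 * D * p₁) * s * (p * J)
          ≤⟨ +-monoˡ-≤ (2 * (4 * D * p₁) * s * (p * J)) Lc+8Dp₁ps≤Ln ⟩
        L * n + 2 * (4 * D * p₁) * s * (p * J)           ≡⟨ +-comm (L * n) _ ⟩
        2 * (4 * D * p₁) * s * (p * J) + L * n           ∎))
        where
        1≤8Dp₁s : 1 ≤ 2 * (4 * D * p₁) * s
        1≤8Dp₁s = *-mono-≤ {1} {2 * (4 * D * p₁)} (*-mono-≤ {1} {2} (s≤s z≤n) (*-mono-≤ {1} {4 * D} (*-mono-≤ {1} {4} (s≤s z≤n) 1≤D) (s≤s z≤n))) (≤-trans (s≤s z≤n) n<s)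
        Lc+8Dp₁ps≤Ln : L * ((3 * pp + 5) * N) + 2 * (4 * D * p₁) * p * s ≤ L * n
        Lc+8Dp₁ps≤Ln = begin
          L * ((3 * pp + 5) * N) + 2 * (4 * D * p₁) * p * s       ≤⟨ +-monoʳ-≤ (L * ((3 * pp + 5) * N)) (*-monoʳ-≤ (2 * (4 * D * p₁) * p) s≤2n) ⟩
          L * ((3 * pp + 5) * N) + 2 * (4 * D * p₁) * p * (2 * n) ≤⟨ +-monoʳ-≤ (L * ((3 * pp + 5) * N)) (≤-trans (≤-reflexive (eq (4 * D * p₁) p n)) (*-monoʳ-≤ (4 * (4 * D * p₁) * p) n≤2L)) ⟩
          L * ((3 * pp + 5) * N) + 4 * (4 * D * p₁) * p * (2 * L) ≡⟨ eq′ L ((3 * pp + 5) * N) (4 * D * p₁) p ⟩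
          L * nJ                                                  ≤⟨ *-monoʳ-≤ L nJ≤n ⟩
          L * n                                                   ∎
          where
          eq : ∀ c p n → 2 * c * p * (2 * n) ≡ 4 * c * p * n
          eq = solve-∀
          eq′ : ∀ L x c p → L * x + 4 * c * p * (2 * L) ≡ L * (x + 8 * c * p)
          eq′ = solve-∀
        eq₁ : ∀ c s L n → 2 * c * s * L + L * n ≡ L * (2 * c * s + n)
        eq₁ = solve-∀
        eq₂ : ∀ L a b x → L * (a * b + x) ≡ a * (L * b) + L * x
        eq₂ = solve-∀
        eq₃ : ∀ c p J s x → c * p * (2 * J * s + 2 * s) + x ≡ (x + 2 * c * p * s) + 2 * c * s * (p * J)
        eq₃ = solve-∀

      t≤J : t ≤ J
      t≤J = *-cancelˡ-≤ p₂ (begin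
        p₂ * t          ≡⟨ *-comm p₂ t ⟩
        t * p₂          ≤⟨ m≤n+m (t * p₂) t₂ ⟩
        t₂ + t * p₂     ≡⟨ Δ≡t₂+tp₂ ⟨
        Δ               ≡⟨ m+n∸m≡n (2 * J) Δ ⟨
        2 * J + Δ ∸ 2 * J ≡⟨ cong (_∸ 2 * J) L≡2J+Δ ⟨
        L ∸ 2 * J       ≤⟨ ∸-monoˡ-≤ (2 * J) L≤pJ ⟩
        p * J ∸ 2 * J   ≡⟨ *-distribʳ-∸ J p 2 ⟨
        p₂ * J          ∎)

      opaque
        j : ℕ
        j = J ∸ t

        J≡j+t : J ≡ j + t
        J≡j+t = sym (m∸n+n≡m t≤J)

      wₘᵢₙ<w : wₘᵢₙ < w
      wₘᵢₙ<w = ≤-pred (*-cancelˡ-< (2 * p₁) (suc wₘᵢₙ) (suc w) (begin-strict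
        2 * p₁ * suc wₘᵢₙ   ≡⟨ cong (2 * p₁ *_) (+-comm 1 wₘᵢₙ) ⟩
        nw                 ≤⟨ nw≤n ⟩
        n                  <⟨ n<s ⟩
        s                  <⟨ s<2p₁u ⟩
        2 * p₁ * suc w     ∎))

      1≤w : 1 ≤ w
      1≤w = ≤-trans (s≤s z≤n) wₘᵢₙ<w

      -- The remaining k − J blocks: runs of q and q + 1

      2ks≡2Js+2e+wu : 2 * k * s ≡ 2 * J * s + (2 * e + w * u)
      2ks≡2Js+2e+wu = begin-equality
        2 * k * s                         ≡⟨ 2ks≡ ⟩
        n * suc n                         ≡⟨ n[n+1]≡ ⟩
        L * (n + u) + w * u               ≡⟨ cong (_+ w * u) L[n+u]≡2Js+2e ⟩
        2 * J * s + 2 * e + w * u         ≡⟨ +-assoc (2 * J * s) (2 * e) (w * u) ⟩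
        2 * J * s + (2 * e + w * u)       ∎

      J<k : J < k
      J<k = *-cancelˡ-< (2 * s) J k (begin-strict
        2 * s * J                       ≡⟨ eq s J ⟩
        2 * J * s                       <⟨ m<m+n (2 * J * s) (≤-trans (*-mono-≤ 1≤w (s≤s z≤n)) (m≤n+m (w * u) (2 * e))) ⟩
        2 * J * s + (2 * e + w * u)     ≡⟨ 2ks≡2Js+2e+wu ⟨
        2 * k * s                       ≡⟨ eq s k ⟨
        2 * s * k                       ∎)
        where
        eq : ∀ s J → 2 * s * J ≡ 2 * J * s
        eq = solve-∀

      opaque
        R : ℕ
        R = k ∸ J

        k≡J+R : k ≡ J + R
        k≡J+R = sym (m+[n∸m]≡n (<⇒≤ J<k))

        1≤R : 1 ≤ R
        1≤R = m<n⇒0<n∸m J<k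

      instance
        R≢0 : NonZero R
        R≢0 = >-nonZero 1≤R

      2Rs≡wu+2e : 2 * R * s ≡ w * u + 2 * e
      2Rs≡wu+2e = +-cancelˡ-≡ (2 * J * s) _ _ (begin-equality
        2 * J * s + 2 * R * s       ≡⟨ eq J R s ⟩
        2 * (J + R) * s             ≡⟨ cong (λ x → 2 * x * s) k≡J+R ⟨
        2 * k * s                   ≡⟨ 2ks≡2Js+2e+wu ⟩
        2 * J * s + (2 * e + w * u) ≡⟨ cong (2 * J * s +_) (+-comm (2 * e) (w * u)) ⟩
        2 * J * s + (w * u + 2 * e) ∎)
        where
        eq : ∀ J R s → 2 * J * s + 2 * R * s ≡ 2 * (J + R) * s
        eq = solve-∀

      opaque
        q r₂ : ℕ
        q  = w / R
        r₂ = w % R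

        w≡r₂+qR : w ≡ r₂ + q * R
        w≡r₂+qR = m≡m%n+[m/n]*n w R

        r₂<R : r₂ < R
        r₂<R = m%n<n w R

      opaque
        a₄ : ℕ
        a₄ = R ∸ r₂

        R≡a₄+r₂ : R ≡ a₄ + r₂
        R≡a₄+r₂ = sym (m∸n+n≡m (<⇒≤ r₂<R))

        1≤a₄ : 1 ≤ a₄
        1≤a₄ = m<n⇒0<n∸m r₂<R

      w≡qa₄+[q+1]r₂ : w ≡ q * a₄ + suc q * r₂
      w≡qa₄+[q+1]r₂ = begin-equality
        w                    ≡⟨ w≡r₂+qR ⟩
        r₂ + q * R           ≡⟨ cong (λ x → r₂ + q * x) R≡a₄+r₂ ⟩
        r₂ + q * (a₄ + r₂)   ≡⟨ eq r₂ q a₄ ⟩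
        q * a₄ + suc q * r₂  ∎
        where
        eq : ∀ r q a → r + q * (a + r) ≡ q * a + suc q * r
        eq = solve-∀

      [4+pp]R≤w : (4 + pp) * R ≤ w
      [4+pp]R≤w = *-cancelˡ-≤ (2 * s) (begin
        2 * s * ((4 + pp) * R)               ≡⟨ eq₁ s (4 + pp) R ⟩
        (4 + pp) * (2 * R * s)               ≡⟨ cong ((4 + pp) *_) 2Rs≡wu+2e ⟩
        (4 + pp) * (w * u + 2 * e)           ≤⟨ *-monoʳ-≤ (4 + pp) (+-monoʳ-≤ (w * u) (*-monoʳ-≤ 2 (<⇒≤ e<s))) ⟩
        (4 + pp) * (w * u + 2 * s)           ≡⟨ eq₂ (4 + pp) w s ⟩
        w * ((4 + pp) * suc w) + 2 * s * (4 + pp) ≤⟨ +-monoˡ-≤ (2 * s * (4 + pp)) (*-monoʳ-≤ w [4+pp][w+1]≤4p₁w′) ⟩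
        w * (4 * p₁ * w′) + 2 * s * (4 + pp)  ≡⟨ cong (_+ 2 * s * (4 + pp)) (eq₃ w p₁ w′) ⟩
        2 * (2 * p₁ * w) * w′ + 2 * s * (4 + pp) ≤⟨ +-monoˡ-≤ (2 * s * (4 + pp)) (*-monoˡ-≤ w′ (*-monoʳ-≤ 2 2p₁w≤s)) ⟩
        2 * s * w′ + 2 * s * (4 + pp)         ≡⟨ *-distribˡ-+ (2 * s) w′ (4 + pp) ⟨
        2 * s * (w′ + (4 + pp))               ≡⟨ cong (2 * s *_) w≡w′+4+pp ⟨
        2 * s * w                             ∎)
        where
        [4+pp][5+pp]+4+pp≤w : (4 + pp) * (5 + pp) + (4 + pp) ≤ w
        [4+pp][5+pp]+4+pp≤w = ≤-trans (m≤n+m _ W) (≤-trans (m≤m+n _ ((4 + pp) * ((4 + pp) * pp + 1))) (<⇒≤ wₘᵢₙ<w))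
        w′ : ℕ
        w′ = w ∸ (4 + pp)
        w≡w′+4+pp : w ≡ w′ + (4 + pp)
        w≡w′+4+pp = sym (m∸n+n≡m (≤-trans (m≤n+m (4 + pp) ((4 + pp) * (5 + pp))) [4+pp][5+pp]+4+pp≤w))
        [4+pp][5+pp]≤w′ : (4 + pp) * (5 + pp) ≤ w′
        [4+pp][5+pp]≤w′ = +-cancelʳ-≤ (4 + pp) _ _ (≤-trans [4+pp][5+pp]+4+pp≤w (≤-reflexive w≡w′+4+pp))
        [4+pp][w+1]≤4p₁w′ : (4 + pp) * suc w ≤ 4 * p₁ * w′
        [4+pp][w+1]≤4p₁w′ = begin
          (4 + pp) * suc w                  ≡⟨ cong (λ x → (4 + pp) * suc x) w≡w′+4+pp ⟩
          (4 + pp) * suc (w′ + (4 + pp))    ≡⟨ eq pp w′ ⟩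
          (4 + pp) * w′ + (4 + pp) * (5 + pp) ≤⟨ +-monoʳ-≤ ((4 + pp) * w′) (≤-trans [4+pp][5+pp]≤w′ (m≤m+n w′ ((3 + 3 * pp) * w′))) ⟩
          (4 + pp) * w′ + (4 + 3 * pp) * w′ ≡⟨ eq′ pp w′ ⟩
          4 * p₁ * w′                       ∎
          where
          eq : ∀ pp w′ → (4 + pp) * suc (w′ + (4 + pp)) ≡ (4 + pp) * w′ + (4 + pp) * (5 + pp)
          eq = solve-∀
          eq′ : ∀ pp w′ → (4 + pp) * w′ + (4 + 3 * pp) * w′ ≡ 4 * (2 + pp) * w′
          eq′ = solve-∀
        eq₁ : ∀ s a R → 2 * s * (a * R) ≡ a * (2 * R * s)
        eq₁ = solve-∀
        eq₂ : ∀ a w s → a * (w * suc w + 2 * s) ≡ w * (a * suc w) + 2 * s * a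
        eq₂ = solve-∀
        eq₃ : ∀ w p₁ w′ → w * (4 * p₁ * w′) ≡ 2 * (2 * p₁ * w) * w′
        eq₃ = solve-∀

      4+pp≤q : 4 + pp ≤ q
      4+pp≤q = ≮⇒≥ λ q<4+pp → <-irrefl refl (<-≤-trans (begin-strict
        w              ≡⟨ w≡r₂+qR ⟩
        r₂ + q * R     <⟨ +-monoˡ-< (q * R) r₂<R ⟩
        suc q * R      ≤⟨ *-monoˡ-≤ R q<4+pp ⟩
        (4 + pp) * R   ∎) [4+pp]R≤w)

      w<4p₁R : w < 4 * p₁ * R
      w<4p₁R = *-cancelˡ-< (2 * s) w (4 * p₁ * R) (begin-strict
        2 * s * w                 ≡⟨ *-comm (2 * s) w ⟩
        w * (2 * s)               <⟨ *-monoʳ-< w ⦃ >-nonZero 1≤w ⦄ (*-monoʳ-< 2 s<2p₁u) ⟩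
        w * (2 * (2 * p₁ * u))    ≡⟨ eq₁ w p₁ u ⟩
        4 * p₁ * (w * u)          ≤⟨ *-monoʳ-≤ (4 * p₁) (m≤m+n (w * u) (2 * e)) ⟩
        4 * p₁ * (w * u + 2 * e)  ≡⟨ cong (4 * p₁ *_) 2Rs≡wu+2e ⟨
        4 * p₁ * (2 * R * s)      ≡⟨ eq₂ p₁ R s ⟩
        2 * s * (4 * p₁ * R)      ∎)
        where
        eq₁ : ∀ w p₁ u → w * (2 * (2 * p₁ * u)) ≡ 4 * p₁ * (w * u)
        eq₁ = solve-∀
        eq₂ : ∀ p₁ R s → 4 * p₁ * (2 * R * s) ≡ 2 * s * (4 * p₁ * R)
        eq₂ = solve-∀

      q<4p₁ : q < 4 * p₁
      q<4p₁ = ≰⇒> λ 4p₁≤q → <-irrefl refl (<-≤-trans w<4p₁R (begin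
        4 * p₁ * R   ≤⟨ *-monoˡ-≤ R 4p₁≤q ⟩
        q * R        ≤⟨ m≤n+m (q * R) r₂ ⟩
        r₂ + q * R   ≡⟨ w≡r₂+qR ⟨
        w            ∎))

      b : ℕ
      b = suc q * r₂

      b+1+q≤u : b + 1 + q ≤ u
      b+1+q≤u = begin
        b + 1 + q            ≡⟨ eq b q ⟩
        q * 1 + b + 1        ≤⟨ +-monoˡ-≤ 1 (+-monoˡ-≤ b (*-monoʳ-≤ q 1≤a₄)) ⟩
        q * a₄ + b + 1       ≡⟨ cong (_+ 1) w≡qa₄+[q+1]r₂ ⟨
        w + 1                ≡⟨ +-comm w 1 ⟩
        u                    ∎
        where
        eq : ∀ b q → b + 1 + q ≡ q * 1 + b + 1
        eq = solve-∀

      [q+1][b+1]≤2s : suc q * (b + 1) ≤ 2 * s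
      [q+1][b+1]≤2s = +-cancelʳ-≤ (suc q * q) _ _ (begin
        suc q * (b + 1) + suc q * q   ≡⟨ *-distribˡ-+ (suc q) (b + 1) q ⟨
        suc q * (b + 1 + q)           ≤⟨ *-monoʳ-≤ (suc q) b+1+q≤u ⟩
        suc q * u                     ≤⟨ *-monoˡ-≤ u q<4p₁ ⟩
        4 * p₁ * u                    ≡⟨ eq₁ p₁ u ⟩
        2 * (2 * p₁ * u)              ≤⟨ *-monoʳ-≤ 2 2p₁u≤s+2p₁ ⟩
        2 * (s + 2 * p₁)              ≡⟨ eq₂ s p₁ ⟩
        2 * s + 4 * p₁                ≤⟨ +-monoʳ-≤ (2 * s) (≤-trans (m≤m+n (4 * p₁) (pp * pp + 5 * pp + 12)) (≤-trans (≤-reflexive (eq₃ pp)) (*-mono-≤ (s≤s 4+pp≤q) 4+pp≤q))) ⟩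
        2 * s + suc q * q             ∎)
        where
        eq₁ : ∀ p₁ u → 4 * p₁ * u ≡ 2 * (2 * p₁ * u)
        eq₁ = solve-∀
        eq₂ : ∀ s p₁ → 2 * (s + 2 * p₁) ≡ 2 * s + 4 * p₁
        eq₂ = solve-∀
        eq₃ : ∀ pp → 4 * (2 + pp) + (pp * pp + 5 * pp + 12) ≡ suc (4 + pp) * (4 + pp)
        eq₃ = solve-∀

      b[b+1]≤2r₂s : b * (b + 1) ≤ 2 * r₂ * s
      b[b+1]≤2r₂s = begin
        b * (b + 1)               ≡⟨ eq₁ q r₂ (b + 1) ⟩
        r₂ * (suc q * (b + 1))    ≤⟨ *-monoʳ-≤ r₂ [q+1][b+1]≤2s ⟩
        r₂ * (2 * s)              ≡⟨ eq₂ r₂ s ⟩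
        2 * r₂ * s                ∎
        where
        eq₁ : ∀ q r x → suc q * r * x ≡ r * (suc q * x)
        eq₁ = solve-∀
        eq₂ : ∀ r s → r * (2 * s) ≡ 2 * r * s
        eq₂ = solve-∀

      h X : ℕ
      h = suc (s / 2)
      X = suc n ∸ h

      s<2h : s < 2 * h
      s<2h = subst (s <_) (*-comm h 2) (<-suc-quotient s 2)

      2h≤s+2 : 2 * h ≤ s + 2
      2h≤s+2 = begin
        2 * suc (s / 2)     ≡⟨ eq (s / 2) ⟩
        s / 2 * 2 + 2       ≤⟨ +-monoˡ-≤ 2 (m/n*n≤m s 2) ⟩
        s + 2               ∎
        where
        eq : ∀ x → 2 * suc x ≡ x * 2 + 2
        eq = solve-∀

      h≤1+n : h ≤ suc n
      h≤1+n = *-cancelˡ-≤ 2 (begin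
        2 * h               ≤⟨ 2h≤s+2 ⟩
        s + 2               ≤⟨ +-monoˡ-≤ 2 s≤2n ⟩
        2 * n + 2           ≡⟨ eq n ⟩
        2 * suc n           ∎)
        where
        eq : ∀ n → 2 * n + 2 ≡ 2 * suc n
        eq = solve-∀

      X+h≡ : X + h ≡ suc n
      X+h≡ = m∸n+n≡m h≤1+n

      2n≤2X+s : 2 * n ≤ 2 * X + s
      2n≤2X+s = +-cancelʳ-≤ 2 _ _ (begin
        2 * n + 2           ≡⟨ eq n ⟩
        2 * suc n           ≡⟨ cong (2 *_) X+h≡ ⟨
        2 * (X + h)         ≡⟨ *-distribˡ-+ 2 X h ⟩
        2 * X + 2 * h       ≤⟨ +-monoʳ-≤ (2 * X) 2h≤s+2 ⟩
        2 * X + (s + 2)     ≡⟨ +-assoc (2 * X) s 2 ⟨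
        2 * X + s + 2       ∎)
        where
        eq : ∀ n → 2 * n + 2 ≡ 2 * suc n
        eq = solve-∀

      u≤h : u ≤ h
      u≤h = s≤s w≤s/2

      W<u : W < u
      W<u = s≤s (≤-trans (m≤m+n W _) (≤-trans (m≤m+n _ ((4 + pp) * ((4 + pp) * pp + 1))) (<⇒≤ wₘᵢₙ<w)))

      s+u<pu+h : s + u < p * u + h
      s+u<pu+h = subst (s + u <_) (eq p₁ u h) (+-monoˡ-< u s<p₁u+h)
        where
        s<p₁u+h : s < p₁ * u + h
        s<p₁u+h = *-cancelˡ-≤ 2 (begin
          2 * suc s               ≡⟨ eq′ s ⟩
          suc s + suc s           ≤⟨ +-mono-≤ s<2p₁u s<2h ⟩
          2 * p₁ * u + 2 * h      ≡⟨ eq″ p₁ u h ⟩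
          2 * (p₁ * u + h)        ∎)
          where
          eq′ : ∀ s → 2 * suc s ≡ suc s + suc s
          eq′ = solve-∀
          eq″ : ∀ p₁ u h → 2 * p₁ * u + 2 * h ≡ 2 * (p₁ * u + h)
          eq″ = solve-∀
        eq : ∀ p₁ u h → p₁ * u + h + u ≡ suc p₁ * u + h
        eq = solve-∀

      -- By gap-identity, 4(p − 1)²(Φ⁺ − Φ⁻) exceeds (A₁ − B₁)(A₂ − B₂) − 4p(p − 1)²L, and the window makes both
      -- factors of order n; this quadratic gap is what the margin below needs.
      Φ⁺ Φ⁻ A₁ B₁ A₂ B₂ : ℕ
      Φ⁺ = p₂ * s * (2 * n) + 2 * L * s
      Φ⁻ = p₂ * s * s + p * L * (n + u)
      A₁ = (2 * pp + 3) * s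
      B₁ = 2 * p₁ * n
      A₂ = 2 * p * p₁ * n
      B₂ = c * s

      2DB₁+n<2DA₁ : 2 * D * B₁ + suc n ≤ 2 * D * A₁
      2DB₁+n<2DA₁ = begin
        2 * D * (2 * p₁ * n) + suc n       ≡⟨ eq₁ D p₁ n ⟩
        4 * p₁ * D * n + suc n             ≤⟨ +-monoˡ-≤ (suc n) (*-monoʳ-≤ (4 * p₁ * D) (n≤1+n n)) ⟩
        4 * p₁ * D * suc n + suc n         ≡⟨ eq₂ (4 * p₁ * D) (suc n) ⟩
        (4 * p₁ * D + 1) * suc n           ≤⟨ *-monoˡ-≤ (suc n) (proj₁ window) ⟩
        (2 * pp + 3) * N * suc n           ≡⟨ *-assoc (2 * pp + 3) N (suc n) ⟩
        (2 * pp + 3) * (N * suc n)         ≡⟨ cong ((2 * pp + 3) *_) 2Ds≡ ⟨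
        (2 * pp + 3) * (2 * D * s)         ≡⟨ eq₃ pp D s ⟩
        2 * D * ((2 * pp + 3) * s)         ∎
        where
        eq₁ : ∀ D p₁ n → 2 * D * (2 * p₁ * n) + suc n ≡ 4 * p₁ * D * n + suc n
        eq₁ = solve-∀
        eq₂ : ∀ a b → a * b + b ≡ (a + 1) * b
        eq₂ = solve-∀
        eq₃ : ∀ pp D s → (2 * pp + 3) * (2 * D * s) ≡ 2 * D * ((2 * pp + 3) * s)
        eq₃ = solve-∀

      2DB₂+n≤2DA₂+cN : 2 * D * B₂ + n ≤ 2 * D * A₂ + c * N
      2DB₂+n≤2DA₂+cN = begin
        2 * D * (c * s) + n                 ≡⟨ eq₁ D c s n ⟩
        c * (2 * D * s) + n                 ≡⟨ cong (λ x → c * x + n) 2Ds≡ ⟩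
        c * (N * suc n) + n                 ≡⟨ eq₂ c N n ⟩
        (c * N + 1) * n + c * N             ≤⟨ +-monoˡ-≤ (c * N) (*-monoˡ-≤ n (proj₂ window)) ⟩
        4 * p * p₁ * D * n + c * N          ≡⟨ cong (_+ c * N) (eq₃ p p₁ D n) ⟩
        2 * D * (2 * p * p₁ * n) + c * N    ∎
        where
        eq₁ : ∀ D c s n → 2 * D * (c * s) + n ≡ c * (2 * D * s) + n
        eq₁ = solve-∀
        eq₂ : ∀ c N n → c * (N * suc n) + n ≡ (c * N + 1) * n + c * N
        eq₂ = solve-∀
        eq₃ : ∀ p p₁ D n → 4 * p * p₁ * D * n ≡ 2 * D * (2 * p * p₁ * n)
        eq₃ = solve-∀

      instance
        2D≢0 : NonZero (2 * D)
        2D≢0 = >-nonZero (≤-trans 1≤D (m≤m+n D (D + 0)))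

      B₁≤A₁ : B₁ ≤ A₁
      B₁≤A₁ = *-cancelˡ-≤ (2 * D) (≤-trans (m≤m+n (2 * D * B₁) (suc n)) 2DB₁+n<2DA₁)

      B₂≤A₂ : B₂ ≤ A₂
      B₂≤A₂ = *-cancelˡ-≤ (2 * D) (+-cancelʳ-≤ n _ _ (≤-trans 2DB₂+n≤2DA₂+cN (+-monoʳ-≤ (2 * D * A₂) nc≤n)))

      y₁ y₂ : ℕ
      y₁ = A₁ ∸ B₁
      y₂ = A₂ ∸ B₂

      n<2Dy₁ : suc n ≤ 2 * D * y₁
      n<2Dy₁ = +-cancelˡ-≤ (2 * D * B₁) _ _ (begin
        2 * D * B₁ + suc n      ≤⟨ 2DB₁+n<2DA₁ ⟩
        2 * D * A₁              ≡⟨ cong (2 * D *_) (m+[n∸m]≡n B₁≤A₁) ⟨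
        2 * D * (B₁ + y₁)       ≡⟨ *-distribˡ-+ (2 * D) B₁ y₁ ⟩
        2 * D * B₁ + 2 * D * y₁ ∎)

      n≤2Dy₂+cN : n ≤ 2 * D * y₂ + c * N
      n≤2Dy₂+cN = +-cancelˡ-≤ (2 * D * B₂) _ _ (begin
        2 * D * B₂ + n                  ≤⟨ 2DB₂+n≤2DA₂+cN ⟩
        2 * D * A₂ + c * N              ≡⟨ cong (λ x → 2 * D * x + c * N) (m+[n∸m]≡n B₂≤A₂) ⟨
        2 * D * (B₂ + y₂) + c * N       ≡⟨ eq (2 * D) B₂ y₂ (c * N) ⟩
        2 * D * B₂ + (2 * D * y₂ + c * N) ∎)
        where
        eq : ∀ a b y z → a * (b + y) + z ≡ a * b + (a * y + z)
        eq = solve-∀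

      ρw-terms : ℕ
      ρw-terms = 12 * pp * ρ * w + 3 * pp * ρ * ρ + 4 * pp * pp * ρ * w + 8 * ρ * w + 5 * ρ * ρ

      gap-exact : 4 * p₁ * p₁ * Φ⁺ + A₁ * B₂ + B₁ * A₂ + 4 * p * p₁ * p₁ * L
                ≡ 4 * p₁ * p₁ * Φ⁻ + A₁ * A₂ + B₁ * B₂ + ρw-terms
      gap-exact = subst₂ (λ n s → 4 * p₁ * p₁ * (p₂ * s * (2 * n) + 2 * L * s) + (2 * pp + 3) * s * (c * s)
                                    + 2 * p₁ * n * (2 * p * p₁ * n) + 4 * p * p₁ * p₁ * L
                                ≡ 4 * p₁ * p₁ * (p₂ * s * s + p * L * (n + u)) + (2 * pp + 3) * s * (2 * p * p₁ * n)
                                    + 2 * p₁ * n * (c * s) + ρw-terms)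
                         (sym n≡L+w) (sym s≡ρ+2p₁w) (gap-identity pp L w ρ)

      gap : 4 * p₁ * p₁ * Φ⁻ + y₁ * y₂ ≤ 4 * p₁ * p₁ * Φ⁺ + 4 * p * p₁ * p₁ * L
      gap = ≤-trans (m≤m+n _ ρw-terms) (≤-reflexive (sym (cancel-cross (4 * p₁ * p₁ * Φ⁺) (4 * p₁ * p₁ * Φ⁻)
              (4 * p * p₁ * p₁ * L) ρw-terms y₁ y₂ B₁ B₂
              (subst₂ (λ a₁ a₂ → 4 * p₁ * p₁ * Φ⁺ + a₁ * B₂ + B₁ * a₂ + 4 * p * p₁ * p₁ * L
                               ≡ 4 * p₁ * p₁ * Φ⁻ + a₁ * a₂ + B₁ * B₂ + ρw-terms)
                      (sym (m∸n+n≡m B₁≤A₁)) (sym (m∸n+n≡m B₂≤A₂)) gap-exact))))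

      ZΦ⁻+n²≤ZΦ⁺+Mn : Z * Φ⁻ + n * n ≤ Z * Φ⁺ + M * n
      ZΦ⁻+n²≤ZΦ⁺+Mn = begin
        Z * Φ⁻ + n * n                                ≤⟨ +-monoʳ-≤ (Z * Φ⁻) (*-monoʳ-≤ n n≤2Dy₂+cN) ⟩
        Z * Φ⁻ + n * (2 * D * y₂ + c * N)             ≡⟨ cong (Z * Φ⁻ +_) (*-distribˡ-+ n _ _) ⟩
        Z * Φ⁻ + (n * (2 * D * y₂) + n * (c * N))     ≤⟨ +-monoʳ-≤ (Z * Φ⁻) (+-monoˡ-≤ (n * (c * N)) (*-monoˡ-≤ (2 * D * y₂) (≤-trans (n≤1+n n) n<2Dy₁))) ⟩
        Z * Φ⁻ + (2 * D * y₁ * (2 * D * y₂) + n * (c * N)) ≡⟨ eq₁ D p₁ Φ⁻ y₁ y₂ (n * (c * N)) ⟩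
        4 * D * D * (4 * p₁ * p₁ * Φ⁻ + y₁ * y₂) + n * (c * N)
          ≤⟨ +-monoˡ-≤ (n * (c * N)) (*-monoʳ-≤ (4 * D * D) gap) ⟩
        4 * D * D * (4 * p₁ * p₁ * Φ⁺ + 4 * p * p₁ * p₁ * L) + n * (c * N)
          ≤⟨ +-monoˡ-≤ (n * (c * N)) (*-monoʳ-≤ (4 * D * D) (+-monoʳ-≤ (4 * p₁ * p₁ * Φ⁺) (*-monoʳ-≤ (4 * p * p₁ * p₁) L≤n))) ⟩
        4 * D * D * (4 * p₁ * p₁ * Φ⁺ + 4 * p * p₁ * p₁ * n) + n * (c * N) ≡⟨ eq₂ D p₁ p Φ⁺ n (c * N) ⟩
        Z * Φ⁺ + M * n                                ∎
        where
        eq₁ : ∀ D p₁ Φ y₁ y₂ x → 4 * D * D * (4 * p₁ * p₁) * Φ + (2 * D * y₁ * (2 * D * y₂) + x)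
                               ≡ 4 * D * D * (4 * p₁ * p₁ * Φ + y₁ * y₂) + x
        eq₁ = solve-∀
        eq₂ : ∀ D p₁ p Φ n x → 4 * D * D * (4 * p₁ * p₁ * Φ + 4 * p * p₁ * p₁ * n) + n * x
                             ≡ 4 * D * D * (4 * p₁ * p₁) * Φ + (4 * D * D * (4 * p * p₁ * p₁) + x) * n
        eq₂ = solve-∀

      scaled-gap : W * Φ⁻ + 2 * W * pp * s + 4 * p₂ * s * (W * W) + 4 * p₂ * s * s ≤ W * Φ⁺
      scaled-gap = *-cancelˡ-≤ Z ⦃ >-nonZero 1≤Z ⦄ (+-cancelʳ-≤ (W * M * n) _ _ (begin
        Z * (W * Φ⁻ + 2 * W * pp * s + 4 * p₂ * s * (W * W) + 4 * p₂ * s * s) + W * M * n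
          ≤⟨ +-monoˡ-≤ (W * M * n) (*-monoʳ-≤ Z (+-mono-≤ (+-mono-≤ (+-monoʳ-≤ (W * Φ⁻) (*-monoʳ-≤ (2 * W * pp) s≤2n))
                                                                    (*-monoˡ-≤ (W * W) (*-monoʳ-≤ (4 * p₂) s≤2n)))
                                                          (*-mono-≤ (*-monoʳ-≤ (4 * p₂) s≤2n) s≤2n))) ⟩
        Z * (W * Φ⁻ + 2 * W * pp * (2 * n) + 4 * p₂ * (2 * n) * (W * W) + 4 * p₂ * (2 * n) * (2 * n)) + W * M * n
          ≡⟨ eq₁ Z W Φ⁻ pp p₂ n M ⟩
        W * (Z * Φ⁻) + nW * n + 16 * p₂ * Z * (n * n) ≤⟨ +-monoˡ-≤ (16 * p₂ * Z * (n * n)) (+-monoʳ-≤ (W * (Z * Φ⁻)) (*-monoˡ-≤ n nW≤n)) ⟩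
        W * (Z * Φ⁻) + n * n + 16 * p₂ * Z * (n * n)  ≡⟨ eq₂ Z Φ⁻ n p₂ ⟩
        W * (Z * Φ⁻ + n * n)                          ≤⟨ *-monoʳ-≤ W ZΦ⁻+n²≤ZΦ⁺+Mn ⟩
        W * (Z * Φ⁺ + M * n)                          ≡⟨ eq₃ W Z Φ⁺ M n ⟩
        Z * (W * Φ⁺) + W * M * n                      ∎))
        where
        1≤Z : 1 ≤ Z
        1≤Z = *-mono-≤ {1} {4 * D * D} (*-mono-≤ {1} {4 * D} (*-mono-≤ {1} {4} (s≤s z≤n) 1≤D) 1≤D) (s≤s z≤n)
        eq₁ : ∀ Z W Φ pp p₂ n M → Z * (W * Φ + 2 * W * pp * (2 * n) + 4 * p₂ * (2 * n) * (W * W) + 4 * p₂ * (2 * n) * (2 * n)) + W * M * n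
                                ≡ W * (Z * Φ) + (Z * (4 * W * pp + 8 * p₂ * (W * W)) + W * M) * n + 16 * p₂ * Z * (n * n)
        eq₁ = solve-∀
        eq₂ : ∀ Z Φ n p₂ → (16 * p₂ * Z + 1) * (Z * Φ) + n * n + 16 * p₂ * Z * (n * n) ≡ (16 * p₂ * Z + 1) * (Z * Φ + n * n)
        eq₂ = solve-∀
        eq₃ : ∀ W Z Φ M n → W * (Z * Φ + M * n) ≡ Z * (W * Φ) + W * M * n
        eq₃ = solve-∀

      j-identity : 2 * s * (p₂ * j) + 2 * s * L + 2 * p * e ≡ p * (L * (n + u)) + 2 * t₂ * s
      j-identity = begin-equality
        2 * s * (p₂ * j) + 2 * s * L + 2 * p * e
          ≡⟨ cong (λ x → 2 * s * (p₂ * j) + 2 * s * x + 2 * p * e) (trans L≡2J+Δ (cong₂ (λ a b → 2 * a + b) J≡j+t Δ≡t₂+tp₂)) ⟩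
        2 * s * (p₂ * j) + 2 * s * (2 * (j + t) + (t₂ + t * p₂)) + 2 * p * e ≡⟨ eq s pp j t t₂ e ⟩
        p * (2 * (j + t) * s + 2 * e) + 2 * t₂ * s        ≡⟨ cong (λ x → p * (2 * x * s + 2 * e) + 2 * t₂ * s) J≡j+t ⟨
        p * (2 * J * s + 2 * e) + 2 * t₂ * s              ≡⟨ cong (λ x → p * x + 2 * t₂ * s) L[n+u]≡2Js+2e ⟨
        p * (L * (n + u)) + 2 * t₂ * s                    ∎
        where
        eq : ∀ s pp j t t₂ e → 2 * s * ((1 + pp) * j) + 2 * s * (2 * (j + t) + (t₂ + t * (1 + pp))) + 2 * (3 + pp) * e
                             ≡ (3 + pp) * (2 * (j + t) * s + 2 * e) + 2 * t₂ * s
        eq = solve-∀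

      margin : W * j + 2 * (W * W + e) < W * X
      margin = *-cancelˡ-< (2 * p₂ * s) _ _ (+-cancelʳ-< (W * (2 * s * L + 2 * p * e) + W * p₂ * s * s) _ _ (begin-strict
        2 * p₂ * s * (W * j + 2 * (W * W + e)) + (W * (2 * s * L + 2 * p * e) + W * p₂ * s * s)
          ≡⟨ eq₁ p₂ s W j e L p ⟩
        W * (2 * s * (p₂ * j) + 2 * s * L + 2 * p * e) + 4 * p₂ * s * (W * W) + 4 * p₂ * s * e + W * p₂ * s * s
          ≡⟨ cong (λ x → W * x + 4 * p₂ * s * (W * W) + 4 * p₂ * s * e + W * p₂ * s * s) j-identity ⟩
        W * (p * (L * (n + u)) + 2 * t₂ * s) + 4 * p₂ * s * (W * W) + 4 * p₂ * s * e + W * p₂ * s * s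
          ≡⟨ eq₂ W p L (n + u) t₂ s p₂ e ⟩
        W * Φ⁻ + 2 * W * t₂ * s + 4 * p₂ * s * (W * W) + 4 * p₂ * s * e
          <⟨ +-mono-≤-< (+-monoˡ-≤ (4 * p₂ * s * (W * W)) (+-monoʳ-≤ (W * Φ⁻) (*-monoˡ-≤ s (*-monoʳ-≤ (2 * W) (≤-pred t₂<p₂)))))
                        (*-monoʳ-< (4 * p₂ * s) ⦃ >-nonZero (*-mono-≤ {1} {4 * p₂} (s≤s z≤n) (≤-trans (s≤s z≤n) n<s)) ⦄ e<s) ⟩
        W * Φ⁻ + 2 * W * pp * s + 4 * p₂ * s * (W * W) + 4 * p₂ * s * s
          ≤⟨ scaled-gap ⟩
        W * Φ⁺
          ≤⟨ *-monoʳ-≤ W (+-monoˡ-≤ (2 * L * s) (*-monoʳ-≤ (p₂ * s) 2n≤2X+s)) ⟩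
        W * (p₂ * s * (2 * X + s) + 2 * L * s)
          ≡⟨ eq₃ W p₂ s X L ⟩
        2 * p₂ * s * (W * X) + (W * (2 * s * L) + W * p₂ * s * s)
          ≤⟨ +-monoʳ-≤ (2 * p₂ * s * (W * X)) (+-monoˡ-≤ (W * p₂ * s * s) (*-monoʳ-≤ W (m≤m+n (2 * s * L) (2 * p * e)))) ⟩
        2 * p₂ * s * (W * X) + (W * (2 * s * L + 2 * p * e) + W * p₂ * s * s) ∎))
        where
        eq₁ : ∀ p₂ s W j e L p → 2 * p₂ * s * (W * j + 2 * (W * W + e)) + (W * (2 * s * L + 2 * p * e) + W * p₂ * s * s)
                               ≡ W * (2 * s * (p₂ * j) + 2 * s * L + 2 * p * e) + 4 * p₂ * s * (W * W) + 4 * p₂ * s * e + W * p₂ * s * s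
        eq₁ = solve-∀
        eq₂ : ∀ W p L B t₂ s p₂ e → W * (p * (L * B) + 2 * t₂ * s) + 4 * p₂ * s * (W * W) + 4 * p₂ * s * e + W * p₂ * s * s
                                  ≡ W * (p₂ * s * s + p * L * B) + 2 * W * t₂ * s + 4 * p₂ * s * (W * W) + 4 * p₂ * s * e
        eq₂ = solve-∀
        eq₃ : ∀ W p₂ s X L → W * (p₂ * s * (2 * X + s) + 2 * L * s) ≡ 2 * p₂ * s * (W * X) + (W * (2 * s * L) + W * p₂ * s * s)
        eq₃ = solve-∀

      j<X : j < X
      j<X = *-cancelˡ-< W j X (≤-<-trans (m≤m+n (W * j) _) margin)

      -- Slack at the run boundaries

      J≡j+t₁+t₂ : J ≡ j + (t₁ + t₂)
      J≡j+t₁+t₂ = trans J≡j+t (cong (j +_) t≡t₁+t₂)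

      L≡2j+pt₁+[p+1]t₂ : L ≡ 2 * j + p * t₁ + suc p * t₂
      L≡2j+pt₁+[p+1]t₂ = begin-equality
        L                                        ≡⟨ L≡2J+Δ ⟩
        2 * J + Δ                                ≡⟨ cong₂ (λ a b → 2 * a + b) J≡j+t₁+t₂ Δ≡t₂+tp₂ ⟩
        2 * (j + (t₁ + t₂)) + (t₂ + t * p₂)      ≡⟨ cong (λ x → 2 * (j + (t₁ + t₂)) + (t₂ + x * p₂)) t≡t₁+t₂ ⟩
        2 * (j + (t₁ + t₂)) + (t₂ + (t₁ + t₂) * p₂) ≡⟨ eq j t₁ t₂ pp ⟩
        2 * j + p * t₁ + suc p * t₂              ∎
        where
        eq : ∀ j t₁ t₂ pp → 2 * (j + (t₁ + t₂)) + (t₂ + (t₁ + t₂) * (1 + pp)) ≡ 2 * j + (3 + pp) * t₁ + (4 + pp) * t₂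
        eq = solve-∀

      k≡J+a₄+r₂ : k ≡ J + (a₄ + r₂)
      k≡J+a₄+r₂ = trans k≡J+R (cong (J +_) R≡a₄+r₂)

      n≡L+qa₄+[q+1]r₂ : n ≡ L + q * a₄ + suc q * r₂
      n≡L+qa₄+[q+1]r₂ = trans n≡L+w (trans (cong (L +_) w≡qa₄+[q+1]r₂) (sym (+-assoc L (q * a₄) (suc q * r₂))))

      exact-at-J : 2 * (J * s + e) + L * L ≡ 2 * L * n + L
      exact-at-J = trans (cong (λ x → 2 * x + L * L) Js+e≡T) (topSum-closed L≤n)

      exact-at-k : 2 * ((J + a₄ + r₂) * s + 0) + n * n ≡ 2 * n * n + n
      exact-at-k = begin-equality
        2 * ((J + a₄ + r₂) * s + 0) + n * n   ≡⟨ cong (λ x → 2 * (x * s + 0) + n * n) (trans (+-assoc J a₄ r₂) (sym k≡J+a₄+r₂)) ⟩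
        2 * (k * s + 0) + n * n               ≡⟨ eq k s n ⟩
        2 * k * s + n * n                     ≡⟨ cong (_+ n * n) 2ks≡ ⟩
        n * suc n + n * n                     ≡⟨ eq′ n ⟩
        2 * n * n + n                         ∎
        where
        eq : ∀ k s n → 2 * (k * s + 0) + n * n ≡ 2 * k * s + n * n
        eq = solve-∀
        eq′ : ∀ n → n * suc n + n * n ≡ 2 * n * n + n
        eq′ = solve-∀

      slack-at-j : SlackAt n s j (2 * j)
      slack-at-j = begin
        2 * j * s + 2 * j * (2 * j)   ≡⟨ *-distribˡ-+ (2 * j) s (2 * j) ⟨
        2 * j * (s + 2 * j)           ≤⟨ *-monoʳ-≤ (2 * j) s+2j≤2n+1 ⟩
        2 * j * (2 * n + 1)           ≡⟨ eq j n ⟩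
        2 * (2 * j) * n + 2 * j       ∎
        where
        eq : ∀ j n → 2 * j * (2 * n + 1) ≡ 2 * (2 * j) * n + 2 * j
        eq = solve-∀
        s+2j≤2n+1 : s + 2 * j ≤ 2 * n + 1
        s+2j≤2n+1 = +-cancelʳ-≤ 3 _ _ (begin
          s + 2 * j + 3             ≡⟨ eq₁ s j ⟩
          2 * suc j + suc s         ≤⟨ +-mono-≤ (*-monoʳ-≤ 2 j<X) s<2h ⟩
          2 * X + 2 * h             ≡⟨ *-distribˡ-+ 2 X h ⟨
          2 * (X + h)               ≡⟨ cong (2 *_) X+h≡ ⟩
          2 * suc n                 ≤⟨ m≤m+n (2 * suc n) 2 ⟩
          2 * suc n + 2             ≡⟨ eq₂ n ⟩
          2 * n + 1 + 3             ∎)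
          where
          eq₁ : ∀ s j → s + 2 * j + 3 ≡ 2 * suc j + suc s
          eq₁ = solve-∀
          eq₂ : ∀ n → 2 * suc n + 2 ≡ 2 * n + 1 + 3
          eq₂ = solve-∀

      [p+1]x[[p+1]x+2w+1]≤2xs : ∀ x → x < p₂ → suc p * x * (suc p * x + 2 * w + 1) ≤ 2 * x * s
      [p+1]x[[p+1]x+2w+1]≤2xs zero    _    = ≤-reflexive (eq pp w)
        where
        eq : ∀ pp w → (4 + pp) * 0 * ((4 + pp) * 0 + 2 * w + 1) ≡ 0
        eq = solve-∀
      [p+1]x[[p+1]x+2w+1]≤2xs (suc x) x<pp = begin
        suc p * suc x * (suc p * suc x + 2 * w + 1) ≤⟨ *-monoʳ-≤ (suc p * suc x) (+-monoˡ-≤ 1 (+-monoˡ-≤ (2 * w) (*-monoʳ-≤ (suc p) (≤-pred x<pp)))) ⟩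
        suc p * suc x * (suc p * pp + 2 * w + 1)    ≡⟨ eq₁ (suc p) (suc x) (suc p * pp + 2 * w + 1) ⟩
        suc x * (suc p * (suc p * pp + 2 * w + 1))  ≤⟨ *-monoʳ-≤ (suc x) inner ⟩
        suc x * (2 * s)                             ≡⟨ eq₂ (suc x) s ⟩
        2 * suc x * s                               ∎
        where
        eq₁ : ∀ a x y → a * x * y ≡ x * (a * y)
        eq₁ = solve-∀
        eq₂ : ∀ x s → x * (2 * s) ≡ 2 * x * s
        eq₂ = solve-∀
        inner : (4 + pp) * ((4 + pp) * pp + 2 * w + 1) ≤ 2 * s
        inner = begin
          (4 + pp) * ((4 + pp) * pp + 2 * w + 1)            ≡⟨ eq pp w ⟩
          (4 + pp) * ((4 + pp) * pp + 1) + (8 + 2 * pp) * w ≤⟨ +-monoˡ-≤ ((8 + 2 * pp) * w) (≤-trans (m≤n+m ((4 + pp) * ((4 + pp) * pp + 1)) (W + ((4 + pp) * (5 + pp) + (4 + pp)))) (<⇒≤ wₘᵢₙ<w)) ⟩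
          w + (8 + 2 * pp) * w                              ≤⟨ +-monoˡ-≤ ((8 + 2 * pp) * w) (≤-trans (≤-reflexive (sym (*-identityˡ w))) (*-monoˡ-≤ w (≤-trans (s≤s z≤n) (≤-trans (≤-pred x<pp) (m≤m+n pp (pp + 0)))))) ⟩
          2 * pp * w + (8 + 2 * pp) * w                     ≡⟨ eq′ pp w ⟩
          2 * (2 * p₁ * w)                                  ≤⟨ *-monoʳ-≤ 2 2p₁w≤s ⟩
          2 * s                                             ∎
          where
          eq : ∀ pp w → (4 + pp) * ((4 + pp) * pp + 2 * w + 1) ≡ (4 + pp) * ((4 + pp) * pp + 1) + (8 + 2 * pp) * w
          eq = solve-∀
          eq′ : ∀ pp w → 2 * pp * w + (8 + 2 * pp) * w ≡ 2 * (2 * (2 + pp) * w)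
          eq′ = solve-∀

      slack-at-j+t₁ : SlackAt n s (j + t₁) (2 * j + p * t₁)
      slack-at-j+t₁ = slack-before-run {n} {s} {j + t₁} {2 * j + p * t₁} {a = t₂} {β = suc p * t₂} {w = w} {e = e}
        (trans n≡L+w (cong (_+ w) L≡2j+pt₁+[p+1]t₂))
        (subst₂ (λ B Q → 2 * (B * s + e) + Q * Q ≡ 2 * Q * n + Q)
                (trans J≡j+t₁+t₂ (sym (+-assoc j t₁ t₂))) L≡2j+pt₁+[p+1]t₂ exact-at-J)
        ([p+1]x[[p+1]x+2w+1]≤2xs t₂ t₂<p₂)

      j+t₁+t₂≡J : j + t₁ + t₂ ≡ J
      j+t₁+t₂≡J = trans (+-assoc j t₁ t₂) (sym J≡j+t₁+t₂)

      slack-at-J : SlackAt n s (j + t₁ + t₂) (2 * j + p * t₁ + suc p * t₂)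
      slack-at-J = subst₂ (SlackAt n s) (sym j+t₁+t₂≡J) L≡2j+pt₁+[p+1]t₂ (begin
        2 * J * s + L * L          ≡⟨ cong (_+ L * L) (*-assoc 2 J s) ⟩
        2 * (J * s) + L * L        ≤⟨ +-monoˡ-≤ (L * L) (*-monoʳ-≤ 2 (m≤m+n (J * s) e)) ⟩
        2 * (J * s + e) + L * L    ≡⟨ exact-at-J ⟩
        2 * L * n + L              ∎)

      slack-at-J+a₄ : SlackAt n s (j + t₁ + t₂ + a₄) (2 * j + p * t₁ + suc p * t₂ + q * a₄)
      slack-at-J+a₄ = subst₂ (SlackAt n s) (cong (_+ a₄) (sym j+t₁+t₂≡J)) (cong (_+ q * a₄) L≡2j+pt₁+[p+1]t₂)
        (slack-before-run {n} {s} {J + a₄} {L + q * a₄} {r₂} {b} {0} {0}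
          (trans n≡L+qa₄+[q+1]r₂ (sym (+-identityʳ _)))
          (subst (λ m → 2 * ((J + a₄ + r₂) * s + 0) + m * m ≡ 2 * m * n + m) n≡L+qa₄+[q+1]r₂ exact-at-k)
          (subst (λ x → b * x ≤ 2 * r₂ * s) (cong (_+ 1) (sym (+-identityʳ b))) b[b+1]≤2r₂s))

      slack-at-k : SlackAt n s (j + t₁ + t₂ + a₄ + r₂) (2 * j + p * t₁ + suc p * t₂ + q * a₄ + suc q * r₂)
      slack-at-k = subst₂ (SlackAt n s) (cong (λ x → x + a₄ + r₂) (sym j+t₁+t₂≡J))
        (trans n≡L+qa₄+[q+1]r₂ (cong (λ x → x + q * a₄ + suc q * r₂) L≡2j+pt₁+[p+1]t₂))
        (≤-reflexive (trans (cong (_+ n * n) (sym (eq (J + a₄ + r₂) s))) exact-at-k))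
        where
        eq : ∀ k s → 2 * (k * s + 0) ≡ 2 * k * s
        eq = solve-∀

      large-runs runs : Runs
      large-runs = (t₁ , p) ∷ (t₂ , suc p) ∷ (a₄ , q) ∷ (r₂ , suc q) ∷ []
      runs       = (j , 2) ∷ large-runs

      count≡k : count runs ≡ k
      count≡k = begin-equality
        j + (t₁ + (t₂ + (a₄ + (r₂ + 0))))  ≡⟨ eq j t₁ t₂ a₄ r₂ ⟩
        j + (t₁ + t₂) + (a₄ + r₂)          ≡⟨ cong (_+ (a₄ + r₂)) J≡j+t₁+t₂ ⟨
        J + (a₄ + r₂)                      ≡⟨ k≡J+a₄+r₂ ⟨
        k                                  ∎
        where
        eq : ∀ j t₁ t₂ a₄ r₂ → j + (t₁ + (t₂ + (a₄ + (r₂ + 0)))) ≡ j + (t₁ + t₂) + (a₄ + r₂)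
        eq = solve-∀

      total≡n : total runs ≡ n
      total≡n = begin-equality
        2 * j + (p * t₁ + (suc p * t₂ + (q * a₄ + (suc q * r₂ + 0)))) ≡⟨ eq (2 * j) (p * t₁) (suc p * t₂) (q * a₄) (suc q * r₂) ⟩
        2 * j + p * t₁ + suc p * t₂ + q * a₄ + suc q * r₂             ≡⟨ cong (λ x → x + q * a₄ + suc q * r₂) L≡2j+pt₁+[p+1]t₂ ⟨
        L + q * a₄ + suc q * r₂                                       ≡⟨ n≡L+qa₄+[q+1]r₂ ⟨
        n                                                             ∎
        where
        eq : ∀ a b c d e → a + (b + (c + (d + (e + 0)))) ≡ a + b + c + d + e
        eq = solve-∀

      p≤q : p ≤ q
      p≤q = ≤-trans (n≤1+n p) 4+pp≤q

      sorted : Linked _≤ₚ_ runs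
      sorted = m≤m+n 2 (1 + pp) ∷ n≤1+n p ∷ 4+pp≤q ∷ n≤1+n q ∷ [-]

      positive : All (λ r → 1 ≤ proj₂ r) runs
      positive = s≤s z≤n ∷ s≤s z≤n ∷ s≤s z≤n ∷ ≤-trans (s≤s z≤n) p≤q ∷ s≤s z≤n ∷ []

      boundaries : BoundarySlack n s runs 0 0
      boundaries = slack-at-j , slack-at-j+t₁ , slack-at-J , slack-at-J+a₄ , slack-at-k , tt

      open RunInstance n s runs (≤-trans (s≤s z≤n) 6≤n) (subst (1 ≤_) (sym count≡k) (≤-trans (s≤s z≤n) J<k))
                       (subst (λ x → 2 * x * s ≡ n * suc n) (sym count≡k) 2ks≡) total≡n positive sorted boundaries
        public using (espp)
        renaming (not-solvable to runs-not-solvable)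

      ∑<J-parts≡L : ∑[ y < J ] part runs y ≡ L
      ∑<J-parts≡L = begin-equality
        ∑[ y < J ] part runs y                       ≡⟨ cong (λ x → ∑[ y < x ] part runs y) J≡j+t₁+t₂ ⟩
        ∑[ y < j + (t₁ + t₂) ] part runs y           ≡⟨ ∑<-part-tail {j} {2} {large-runs} (t₁ + t₂) ⟩
        2 * j + ∑[ y < t₁ + t₂ ] part large-runs y   ≡⟨ cong (2 * j +_) (∑<-part-tail {t₁} {p} {rest} t₂) ⟩
        2 * j + (p * t₁ + ∑[ y < t₂ ] part rest y)   ≡⟨ cong (λ x → 2 * j + (p * t₁ + x)) (∑<-part-head {t₂} {suc p} {rest′} ≤-refl) ⟩
        2 * j + (p * t₁ + suc p * t₂)                ≡⟨ +-assoc (2 * j) (p * t₁) (suc p * t₂) ⟨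
        2 * j + p * t₁ + suc p * t₂                  ≡⟨ L≡2j+pt₁+[p+1]t₂ ⟨
        L                                            ∎
        where
        rest′ rest : Runs
        rest′ = (a₄ , q) ∷ (r₂ , suc q) ∷ []
        rest  = (t₂ , suc p) ∷ rest′

      p≤large-parts : ∀ y → j ≤ y → y < J → p ≤ part runs y
      p≤large-parts y j≤y y<J = begin
        p                          ≤⟨ part-lower p≤large (subst (y ∸ j <_) (m+n∸m≡n j _) (∸-monoˡ-< y<count j≤y)) ⟩
        part large-runs (y ∸ j)    ≡⟨ part-tail {j} {2} {large-runs} (y ∸ j) ⟨
        part runs (j + (y ∸ j))    ≡⟨ cong (part runs) (m+[n∸m]≡n j≤y) ⟩
        part runs y                ∎
        where
        p≤large : All (λ r → p ≤ proj₂ r) large-runs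
        p≤large = ≤-refl ∷ n≤1+n p ∷ p≤q ∷ ≤-trans p≤q (n≤1+n q) ∷ []
        y<count : y < count runs
        y<count = <-≤-trans y<J (≤-trans (<⇒≤ J<k) (≤-reflexive (sym count≡k)))

      not-solvable : ¬ Solvable espp
      not-solvable = runs-not-solvable {j} {J} {L} {e} {u} {h} {W} {X} {p}
        (≤-trans (m≤m+n j t) (≤-reflexive (sym J≡j+t))) (≤-trans (<⇒≤ J<k) (≤-reflexive (sym count≡k)))
        ∑<J-parts≡L p≤large-parts Js+e≡T L+u≡ u≤h W<u X+h≡ s<2h s+u<pu+h margin

  -- opaque: the theorem needs only this statement, and unfolding the construction is prohibitively expensive
  opaque
    unsolvable-instances : ∀ {N D pp} → 1 ≤ D → 2 * D < N → 7 * N < 24 * D → Coprime N D → InWindow N D pp →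
      ∀ N₀ → ∃[ m ] ∃[ I ] (N₀ ≤ ESPP.n I × ESPP.n I ≡ N * m × ESPP.k I ≡ D * m × ¬ Solvable I)
    unsolvable-instances {N} {D} {pp} 1≤D 2D<N 7N<24D coprime window N₀ with base-solution 1≤D coprime
    ... | m₀ , s₀ , 2Ds₀≡ = m , Instance.espp n s (D * m) 2Ds≡ 2ks≡ large , ≤-trans (m≤n+m N₀ threshold) i≤n , refl
                          , Instance.count≡k n s (D * m) 2Ds≡ 2ks≡ large , Instance.not-solvable n s (D * m) 2Ds≡ 2ks≡ large
      where
      open Construction N D pp 1≤D 2D<N 7N<24D window using (threshold; module Instance)
      -- m ≡ m₀ modulo 2D keeps s = N (n + 1) / (2D) integral, and i makes n large
      i m n s : ℕ
      i = threshold + N₀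
      m = m₀ + 2 * D * i
      n = N * m
      s = s₀ + N * N * i
      2Ds≡ : 2 * D * s ≡ N * suc n
      2Ds≡ = begin-equality
        2 * D * (s₀ + N * N * i)               ≡⟨ *-distribˡ-+ (2 * D) s₀ (N * N * i) ⟩
        2 * D * s₀ + 2 * D * (N * N * i)       ≡⟨ cong (_+ 2 * D * (N * N * i)) 2Ds₀≡ ⟩
        N * (N * m₀ + 1) + 2 * D * (N * N * i) ≡⟨ eq N m₀ D i ⟩
        N * suc (N * (m₀ + 2 * D * i))         ∎
        where
        eq : ∀ N m₀ D i → N * (N * m₀ + 1) + 2 * D * (N * N * i) ≡ N * suc (N * (m₀ + 2 * D * i))
        eq = solve-∀
      2ks≡ : 2 * (D * m) * s ≡ n * suc n
      2ks≡ = begin-equality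
        2 * (D * m) * s    ≡⟨ eq₁ D m s ⟩
        m * (2 * D * s)    ≡⟨ cong (m *_) 2Ds≡ ⟩
        m * (N * suc n)    ≡⟨ eq₂ m N (suc n) ⟩
        N * m * suc n      ∎
        where
        eq₁ : ∀ D m s → 2 * (D * m) * s ≡ m * (2 * D * s)
        eq₁ = solve-∀
        eq₂ : ∀ m N x → m * (N * x) ≡ N * m * x
        eq₂ = solve-∀
      i≤n : i ≤ n
      i≤n = begin
        i          ≤⟨ m≤n*m i (2 * D) ⦃ >-nonZero (≤-trans 1≤D (m≤m+n D (D + 0))) ⦄ ⟩
        2 * D * i  ≤⟨ m≤n+m (2 * D * i) m₀ ⟩
        m          ≤⟨ m≤n*m m N ⦃ >-nonZero (≤-trans (s≤s z≤n) 2D<N) ⦄ ⟩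
        N * m      ∎
      large : threshold ≤ n
      large = ≤-trans (m≤m+n threshold N₀) i≤n

open import Defs
open import Data.Nat using (ℕ; _≤_)
open import Data.Integer using (+_)
open import Data.Rational using (ℚ; _/_; _<_; _*_)
open import Data.Product using (Σ; _×_; ∃; _,_)
open import Relation.Binary.PropositionalEquality using (_≡_)
open import Relation.Nullary using (¬_)
open Arithmetic using (module NumDen; numDen; choose-window)
open HardInstances using (unsolvable-instances)

theorem1p10 : (a : ℚ) → (+ 2 / 1) < a → a < (+ 24 / 7) →
    ∀ (N : ℕ) → ∃ λ (I : ESPP) →
      (N ≤ ESPP.n I) × (a * (+ ESPP.k I / 1) ≡ (+ ESPP.n I / 1)) × ¬ Solvable I
theorem1p10 a 2<a a<24/7 N₀ =
  let open NumDen (numDen a 2<a a<24/7)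
      (pp , window) = choose-window {N} {D} 2D<N 7N<24D
      (m , I , N₀≤n , n≡Nm , k≡Dm , ¬solvable) = unsolvable-instances {N} {D} {pp} 1≤D 2D<N 7N<24D coprime window N₀
  in I , N₀≤n , ratio k≡Dm n≡Nm , ¬solvable
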